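{- Fix a raw type theory. Let $\Xi=[M_1:\mathcal{B}\!\!\mathcal{B}_1,\dots,M_n:\mathcal{B}\!\!\mathcal{B}_n]$ be a metavariable context and $e$ an argument over $\Xi_{(k)};\emptyset$ with the arity of $\mathcal{B}\!\!\mathcal{B}_k$. The basic instantiation $\langle\Xi;M_k\mapsto e\rangle$ is derivable (as an instantiation of $\Xi$ over $\Xi[M_k\mapsto e];\emptyset$) if $\vdash\Xi\ \mathsf{mctx}$ and $\Xi_{(k)};\emptyset\vdash\lceil\mathcal{B}\!\!\mathcal{B}_k\rceil(e)$ are derivable, in which case $\vdash\Xi[M_k\mapsto e]\ \mathsf{mctx}$ is also derivable.
   Context: Finitary type theory syntax: expressions built from free variables, bound variables, symbol applications and metavariable applications $M(\vec t)$; arguments may be dummies $\star$ or abstractions $\{x\}e$. Boundaries "$\Box$ type", "$\Box:A$" (object), "$A\equiv B$ by $\Box$", "$s\equiv t:A$ by $\Box$" (equation), and their abstractions; $\lceil\mathcal{B}\!\!\mathcal{B}\rceil(e)$ fills the hole with head $e$. A metavariable context $\Xi=[M_1:\mathcal{B}\!\!\mathcal{B}_1,\dots,M_n:\mathcal{B}\!\!\mathcal{B}_n]$ assigns closed boundaries, $\mathcal{B}\!\!\mathcal{B}_i$ mentioning only $M_1,\ldots,M_{i-1}$; $\Xi_{(k)}=[M_1:\mathcal{B}\!\!\mathcal{B}_1,\ldots,M_{k-1}:\mathcal{B}\!\!\mathcal{B}_{k-1}]$. $\vdash\Xi\ \mathsf{mctx}$ means each $\mathcal{B}\!\!\mathcal{B}_i$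 is a derivable boundary over $\Xi_{(i)};\emptyset$ and the $M_i$ are distinct. An instantiation $I=[M_1\mapsto e_1,\ldots]$ of $\Xi$ over $\Theta;\Gamma$ assigns arguments of matching arity and acts by substitution $I_*$; $I_{(i)}$ is its restriction to $M_1,\ldots,M_{i-1}$; it is derivable if $\Theta;\Gamma\vdash\lceil(I_{(i)})_*\mathcal{B}\!\!\mathcal{B}_i\rceil(e_i)$ for all $i$. The generic application $\hat M$ of a metavariable of arity $(c,n)$ is $\{x_1\}\cdots\{x_n\}M(x_1,\dots,x_n)$ for object metavariables and $\{x_1\}\cdots\{x_n\}\star$ for equational ones. The basic instantiation $\langle\Xi;M_k\mapsto e\rangle$ maps $M_k\mapsto e$ and $M_i\mapsto\hat M_i$ for $i\neq k$; it is an instantiation of $\Xi$ over the metavariable context $\Xi[M_k\mapsto e]=[M_1:\mathcal{B}\!\!\mathcal{B}'_1,\dots,M_{k-1}:\mathcal{B}\!\!\mathcal{B}'_{k-1},M_{k+1}:\mathcal{B}\!\!\mathcal{B}'_{k+1},\dots,M_n:\mathcal{B}\!\!\mathcal{B}'_n]$ and the empty variable context, where $\mathcal{B}\!\!\mathcal{B}'_j=(\langle\Xi;M_k\mapsto e\rangle_{(j)})_*\mathcal{B}\!\!\mathcal{B}_j$. A raw type theory is a family of raw rules; derivability is generated by the structural rules (variable, metavariable, abstraction, equality, conversion, boundary formation), rule instances and congruence rules. -}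

module Defs where

-- Finitary type theories (Haselwarter--Bauer style), well-scoped de Bruijn rendering.
-- Variable scopes are natural numbers; variable 0 is the innermost (most recent).
-- Metavariable context shapes are lists of arities whose HEAD is the LAST metavariable.

open import Data.Nat using (ℕ; zero; suc; _+_)
open import Data.Fin using (Fin; zero; suc; _↑ˡ_; _↑ʳ_)
open import Data.Vec using (Vec; []; _∷_)
open import Data.List using (List; []; _∷_)
open import Data.List.Relation.Unary.All using (All; []; _∷_)
open import Data.Product using (_×_; _,_)
open import Data.Unit using (⊤; tt)
open import Data.Empty using (⊥)
open import Function using (id; _∘_)

data OC : Set where
  ty tm : OC

data Class : Set where
  obj : OC → Class
  eq  : OC → Class

-- arity of an argument / metavariable: (class, number of bound variables)
Arity : Set
Arity = Class × ℕ

record Signature : Set₁ where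
  field
    Symb : Set
    symClass : Symb → OC
    symArgs  : Symb → List Arity

data MVar : List Arity → Arity → Set where
  here  : ∀ {a ms} → MVar (a ∷ ms) a
  there : ∀ {a b ms} → MVar ms a → MVar (b ∷ ms) a

private variable
  ms ns ps sh : List Arity
  a b : Arity
  as : List Arity
  γ δ ε : ℕ
  n : ℕ
  c : OC
  cl : Class

module _ {sig : Signature} where
  open Signature sig

  data Expr (ms : List Arity) (γ : ℕ) : OC → Set
  data Arg  (ms : List Arity) (γ : ℕ) : Arity → Set
  data Args (ms : List Arity) (γ : ℕ) : List Arity → Set

  data Expr ms γ where
    var : Fin γ → Expr ms γ tm
    sym : (S : Symb) → Args ms γ (symArgs S) → Expr ms γ (symClass S)
    mv  : ∀ {c n} → MVar ms (obj c , n) → Vec (Expr ms γ tm) n → Expr ms γ c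

  -- arguments: abstractions {x1}...{xn} e, with e an expression or a dummy ⋆
  data Arg ms γ where
    expr : ∀ {c} → Expr ms γ c → Arg ms γ (obj c , 0)
    ⋆    : ∀ {c} → Arg ms γ (eq c , 0)
    abs  : ∀ {cl n} → Arg ms (suc γ) (cl , n) → Arg ms γ (cl , suc n)

  data Args ms γ where
    []  : Args ms γ []
    _∷_ : ∀ {a as} → Arg ms γ a → Args ms γ as → Args ms γ (a ∷ as)

  data Bdry (ms : List Arity) (γ : ℕ) : Class → Set where
    □type : Bdry ms γ (obj ty)
    □∶_   : Expr ms γ ty → Bdry ms γ (obj tm)
    _≡_by□ : Expr ms γ ty → Expr ms γ ty → Bdry ms γ (eq ty)
    _≡_∶_by□ : Expr ms γ tm → Expr ms γ tm → Expr ms γ ty → Bdry ms γ (eq tm)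

  data BBdry (ms : List Arity) (γ : ℕ) : Arity → Set where
    bdry : ∀ {cl} → Bdry ms γ cl → BBdry ms γ (cl , 0)
    babs : ∀ {cl n} → Expr ms γ ty → BBdry ms (suc γ) (cl , n) → BBdry ms γ (cl , suc n)

  data Judg (ms : List Arity) (γ : ℕ) : Class → Set where
    isType : Expr ms γ ty → Judg ms γ (obj ty)
    hasType : Expr ms γ tm → Expr ms γ ty → Judg ms γ (obj tm)
    eqType : Expr ms γ ty → Expr ms γ ty → Judg ms γ (eq ty)
    eqTerm : Expr ms γ tm → Expr ms γ tm → Expr ms γ ty → Judg ms γ (eq tm)

  data JJudg (ms : List Arity) (γ : ℕ) : Arity → Set where
    judg : ∀ {cl} → Judg ms γ cl → JJudg ms γ (cl , 0)
    jabs : ∀ {cl n} → Expr ms γ ty → JJudg ms (suc γ) (cl , n) → JJudg ms γ (cl , suc n)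

  fill₀ : ∀ {ms γ cl} → Bdry ms γ cl → Arg ms γ (cl , 0) → Judg ms γ cl
  fill₀ □type (expr A) = isType A
  fill₀ (□∶ A) (expr t) = hasType t A
  fill₀ (A ≡ B by□) ⋆ = eqType A B
  fill₀ (s ≡ t ∶ A by□) ⋆ = eqTerm s t A

  fill : ∀ {ms γ a} → BBdry ms γ a → Arg ms γ a → JJudg ms γ a
  fill (bdry b) e = judg (fill₀ b e)
  fill (babs A bb) (abs e) = jabs A (fill bb e)

  fillEq₀ : ∀ {ms γ c} → Bdry ms γ (obj c) → Expr ms γ c → Expr ms γ c → Judg ms γ (eq c)
  fillEq₀ □type A B = eqType A B
  fillEq₀ (□∶ C) s t = eqTerm s t C

  fillEq : ∀ {ms γ c n} → BBdry ms γ (obj c , n) → Arg ms γ (obj c , n) → Arg ms γ (obj c , n)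
         → JJudg ms γ (eq c , n)
  fillEq (bdry b) (expr x) (expr y) = judg (fillEq₀ b x y)
  fillEq (babs A bb) (abs x) (abs y) = jabs A (fillEq bb x y)

  bdryOf : ∀ {ms γ cl} → Judg ms γ cl → Bdry ms γ cl
  bdryOf (isType A) = □type
  bdryOf (hasType t A) = □∶ A
  bdryOf (eqType A B) = A ≡ B by□
  bdryOf (eqTerm s t A) = s ≡ t ∶ A by□

  Ren : ℕ → ℕ → Set
  Ren γ δ = Fin γ → Fin δ

  liftR : ∀ {γ δ} → Ren γ δ → Ren (suc γ) (suc δ)
  liftR ρ zero = zero
  liftR ρ (suc i) = suc (ρ i)

  ren     : ∀ {ms γ δ c} → Ren γ δ → Expr ms γ c → Expr ms δ c
  renVec  : ∀ {ms γ δ n} → Ren γ δ → Vec (Expr ms γ tm) n → Vec (Expr ms δ tm) n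
  renArg  : ∀ {ms γ δ a} → Ren γ δ → Arg ms γ a → Arg ms δ a
  renArgs : ∀ {ms γ δ as} → Ren γ δ → Args ms γ as → Args ms δ as
  ren ρ (var i) = var (ρ i)
  ren ρ (sym S es) = sym S (renArgs ρ es)
  ren ρ (mv M ts) = mv M (renVec ρ ts)
  renVec ρ [] = []
  renVec ρ (t ∷ ts) = ren ρ t ∷ renVec ρ ts
  renArg ρ (expr e) = expr (ren ρ e)
  renArg ρ ⋆ = ⋆
  renArg ρ (abs e) = abs (renArg (liftR ρ) e)
  renArgs ρ [] = []
  renArgs ρ (e ∷ es) = renArg ρ e ∷ renArgs ρ es

  Sub : List Arity → ℕ → ℕ → Set
  Sub ms γ δ = Fin γ → Expr ms δ tm

  liftS : ∀ {ms γ δ} → Sub ms γ δ → Sub ms (suc γ) (suc δ)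
  liftS σ zero = var zero
  liftS σ (suc i) = ren suc (σ i)

  _▸_ : ∀ {ms γ δ} → Expr ms δ tm → Sub ms γ δ → Sub ms (suc γ) δ
  (t ▸ σ) zero = t
  (t ▸ σ) (suc i) = σ i

  noVars : ∀ {ms δ} → Sub ms 0 δ
  noVars ()

  sub     : ∀ {ms γ δ c} → Sub ms γ δ → Expr ms γ c → Expr ms δ c
  subVec  : ∀ {ms γ δ n} → Sub ms γ δ → Vec (Expr ms γ tm) n → Vec (Expr ms δ tm) n
  subArg  : ∀ {ms γ δ a} → Sub ms γ δ → Arg ms γ a → Arg ms δ a
  subArgs : ∀ {ms γ δ as} → Sub ms γ δ → Args ms γ as → Args ms δ as
  sub σ (var i) = σ i
  sub σ (sym S es) = sym S (subArgs σ es)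
  sub σ (mv M ts) = mv M (subVec σ ts)
  subVec σ [] = []
  subVec σ (t ∷ ts) = sub σ t ∷ subVec σ ts
  subArg σ (expr e) = expr (sub σ e)
  subArg σ ⋆ = ⋆
  subArg σ (abs e) = abs (subArg (liftS σ) e)
  subArgs σ [] = []
  subArgs σ (e ∷ es) = subArg σ e ∷ subArgs σ es

  subBdry : ∀ {ms γ δ cl} → Sub ms γ δ → Bdry ms γ cl → Bdry ms δ cl
  subBdry σ □type = □type
  subBdry σ (□∶ A) = □∶ sub σ A
  subBdry σ (A ≡ B by□) = sub σ A ≡ sub σ B by□
  subBdry σ (s ≡ t ∶ A by□) = sub σ s ≡ sub σ t ∶ sub σ A by□

  MRen : List Arity → List Arity → Set
  MRen ms ns = ∀ {a} → MVar ms a → MVar ns a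

  mren     : ∀ {ms ns γ c} → MRen ms ns → Expr ms γ c → Expr ns γ c
  mrenVec  : ∀ {ms ns γ n} → MRen ms ns → Vec (Expr ms γ tm) n → Vec (Expr ns γ tm) n
  mrenArg  : ∀ {ms ns γ a} → MRen ms ns → Arg ms γ a → Arg ns γ a
  mrenArgs : ∀ {ms ns γ as} → MRen ms ns → Args ms γ as → Args ns γ as
  mren μ (var i) = var i
  mren μ (sym S es) = sym S (mrenArgs μ es)
  mren μ (mv M ts) = mv (μ M) (mrenVec μ ts)
  mrenVec μ [] = []
  mrenVec μ (t ∷ ts) = mren μ t ∷ mrenVec μ ts
  mrenArg μ (expr e) = expr (mren μ e)
  mrenArg μ ⋆ = ⋆
  mrenArg μ (abs e) = abs (mrenArg μ e)
  mrenArgs μ [] = []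
  mrenArgs μ (e ∷ es) = mrenArg μ e ∷ mrenArgs μ es

  mrenBdry : ∀ {ms ns γ cl} → MRen ms ns → Bdry ms γ cl → Bdry ns γ cl
  mrenBdry μ □type = □type
  mrenBdry μ (□∶ A) = □∶ mren μ A
  mrenBdry μ (A ≡ B by□) = mren μ A ≡ mren μ B by□
  mrenBdry μ (s ≡ t ∶ A by□) = mren μ s ≡ mren μ t ∶ mren μ A by□

  mrenBB : ∀ {ms ns γ a} → MRen ms ns → BBdry ms γ a → BBdry ns γ a
  mrenBB μ (bdry b) = bdry (mrenBdry μ b)
  mrenBB μ (babs A bb) = babs (mren μ A) (mrenBB μ bb)

  data MCtx : List Arity → Set where
    ∅   : MCtx []
    _▷_ : ∀ {ms a} → MCtx ms → BBdry ms 0 a → MCtx (a ∷ ms)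

  -- the boundary of a metavariable, weakened to the whole context
  lookupM : ∀ {ms a} → MCtx ms → MVar ms a → BBdry ms 0 a
  lookupM (Θ ▷ bb) here = mrenBB there bb
  lookupM (Θ ▷ bb) (there M) = mrenBB there (lookupM Θ M)

  -- Ξ_(k): the metavariables before M_k, and the boundary BB_k over it
  pre : ∀ {ms a} → MVar ms a → List Arity
  pre {_ ∷ ms} here = ms
  pre (there k) = pre k

  _↾_ : ∀ {ms a} → MCtx ms → (k : MVar ms a) → MCtx (pre k)
  (Ξ ▷ bb) ↾ here = Ξ
  (Ξ ▷ bb) ↾ there k = Ξ ↾ k

  _!_ : ∀ {ms a} → MCtx ms → (k : MVar ms a) → BBdry (pre k) 0 a
  (Ξ ▷ bb) ! here = bb
  (Ξ ▷ bb) ! there k = Ξ ! k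

  _─_ : ∀ {a} (ms : List Arity) → MVar ms a → List Arity
  (_ ∷ ms) ─ here = ms
  (b ∷ ms) ─ there k = b ∷ (ms ─ k)

  data VCtx (ms : List Arity) : ℕ → Set where
    ∅   : VCtx ms 0
    _▷_ : ∀ {γ} → VCtx ms γ → Expr ms γ ty → VCtx ms (suc γ)

  lookupTy : ∀ {ms γ} → VCtx ms γ → Fin γ → Expr ms γ ty
  lookupTy (Γ ▷ A) zero = ren suc A
  lookupTy (Γ ▷ A) (suc i) = ren suc (lookupTy Γ i)

  -- Instantiations I = [M1 ↦ e1, ..., Mn ↦ en] of a shape ms over ps;γ
  -- (head of the list instantiates the last metavariable; the tail is I_(n))

  Inst : List Arity → ℕ → List Arity → Set
  Inst ps γ ms = All (Arg ps γ) ms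

  lookupI : ∀ {ps γ ms a} → Inst ps γ ms → MVar ms a → Arg ps γ a
  lookupI (e ∷ I) here = e
  lookupI (e ∷ I) (there M) = lookupI I M

  apply : ∀ {ps γ ε c n} → Arg ps γ (obj c , n) → Sub ps γ ε → Vec (Expr ps ε tm) n → Expr ps ε c
  apply (expr e) σ [] = sub σ e
  apply (abs e) σ (t ∷ ts) = apply e (t ▸ σ) ts

  -- I_* acting on expressions over Ξ with δ (bound) variables, producing expressions over Θ;Γ,δ
  inst     : ∀ {ps γ ms δ c} → Inst ps γ ms → Expr ms δ c → Expr ps (δ + γ) c
  instVec  : ∀ {ps γ ms δ n} → Inst ps γ ms → Vec (Expr ms δ tm) n → Vec (Expr ps (δ + γ) tm) n
  instArg  : ∀ {ps γ ms δ a} → Inst ps γ ms → Arg ms δ a → Arg ps (δ + γ) a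
  instArgs : ∀ {ps γ ms δ as} → Inst ps γ ms → Args ms δ as → Args ps (δ + γ) as
  inst {γ = γ} I (var i) = var (i ↑ˡ γ)
  inst I (sym S es) = sym S (instArgs I es)
  inst {δ = δ} I (mv M ts) = apply (lookupI I M) (λ j → var (δ ↑ʳ j)) (instVec I ts)
  instVec I [] = []
  instVec I (t ∷ ts) = inst I t ∷ instVec I ts
  instArg I (expr e) = expr (inst I e)
  instArg I ⋆ = ⋆
  instArg I (abs e) = abs (instArg I e)
  instArgs I [] = []
  instArgs I (e ∷ es) = instArg I e ∷ instArgs I es

  instBdry : ∀ {ps γ ms δ cl} → Inst ps γ ms → Bdry ms δ cl → Bdry ps (δ + γ) cl
  instBdry I □type = □type
  instBdry I (□∶ A) = □∶ inst I A
  instBdry I (A ≡ B by□) = inst I A ≡ inst I B by□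
  instBdry I (s ≡ t ∶ A by□) = inst I s ≡ inst I t ∶ inst I A by□

  instBB : ∀ {ps γ ms δ a} → Inst ps γ ms → BBdry ms δ a → BBdry ps (δ + γ) a
  instBB I (bdry b) = bdry (instBdry I b)
  instBB I (babs A bb) = babs (inst I A) (instBB I bb)

  instJudg : ∀ {ps γ ms δ cl} → Inst ps γ ms → Judg ms δ cl → Judg ps (δ + γ) cl
  instJudg I (isType A) = isType (inst I A)
  instJudg I (hasType t A) = hasType (inst I t) (inst I A)
  instJudg I (eqType A B) = eqType (inst I A) (inst I B)
  instJudg I (eqTerm s t A) = eqTerm (inst I s) (inst I t) (inst I A)

  wkInst : ∀ {ps γ ms b} → Inst ps γ ms → Inst (b ∷ ps) γ ms
  wkInst [] = []
  wkInst (e ∷ I) = mrenArg there e ∷ wkInst I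

  mvHead : ∀ {ms γ cl n} → MVar ms (cl , n) → Vec (Expr ms γ tm) n → Arg ms γ (cl , 0)
  mvHead {cl = obj c} M ts = expr (mv M ts)
  mvHead {cl = eq c} M ts = ⋆

  hatGo : ∀ {ms γ} cl (r : ℕ)
        → (∀ {δ} → Ren γ δ → Vec (Expr ms δ tm) r → Arg ms δ (cl , 0))
        → Arg ms γ (cl , r)
  hatGo cl zero k = k id []
  hatGo cl (suc r) k = abs (hatGo cl r (λ ρ ts → k (ρ ∘ suc) (var (ρ zero) ∷ ts)))

  hat : ∀ {ms cl n} → MVar ms (cl , n) → Arg ms 0 (cl , n)
  hat {cl = cl} {n = n} M = hatGo cl n (λ _ ts → mvHead M ts)

  genInst : ∀ ms → Inst ms 0 ms
  genInst [] = []
  genInst (b ∷ ms) = hat here ∷ wkInst (genInst ms)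

  basicInst : ∀ {ms a} (Ξ : MCtx ms) (k : MVar ms a) → Arg (pre k) 0 a → Inst (ms ─ k) 0 ms
  basicInst {_ ∷ ms} (Ξ ▷ bb) here e = e ∷ genInst ms
  basicInst (Ξ ▷ bb) (there k) e = hat here ∷ wkInst (basicInst Ξ k e)

  -- Ξ[M_k ↦ e] = [..., M_j : BB'_j, ...] with BB'_j = (⟨Ξ;M_k↦e⟩_(j))_* BB_j
  genCtx : ∀ {ms} → MCtx ms → MCtx ms
  genCtx ∅ = ∅
  genCtx {_ ∷ ms} (Ξ ▷ bb) = genCtx Ξ ▷ instBB (genInst ms) bb

  _[_↦_] : ∀ {ms a} (Ξ : MCtx ms) (k : MVar ms a) → Arg (pre k) 0 a → MCtx (ms ─ k)
  (Ξ ▷ bb) [ here ↦ e ] = genCtx Ξ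
  (Ξ ▷ bb) [ there k ↦ e ] = (Ξ [ k ↦ e ]) ▷ instBB (basicInst Ξ k e) bb

  record RawRule : Set where
    constructor _⊢ʳ_
    field
      {shape} : List Arity
      premises : MCtx shape
      {conclClass} : Class
      conclusion : Judg shape 0 conclClass

  record RawTheory : Set₁ where
    field
      Rule : Set
      rule : Rule → RawRule

  data Goal (ms : List Arity) (γ : ℕ) : Set where
    jdg : ∀ {a} → JJudg ms γ a → Goal ms γ
    bdy : ∀ {a} → BBdry ms γ a → Goal ms γ

  J₀ : ∀ {ms γ cl} → Judg ms γ cl → Goal ms γ
  J₀ j = jdg (judg j)

  B₀ : ∀ {ms γ cl} → Bdry ms γ cl → Goal ms γ
  B₀ b = bdy (bdry b)

  metaArgGoals : ∀ {ms γ' γ cl n} → BBdry ms γ' (cl , n) → Sub ms γ' γ → Vec (Expr ms γ tm) n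
               → List (Goal ms γ)
  metaArgGoals (bdry b) σ [] = []
  metaArgGoals (babs A bb) σ (t ∷ ts) = J₀ (hasType t (sub σ A)) ∷ metaArgGoals bb (t ▸ σ) ts

  metaBdry : ∀ {ms γ' γ cl n} → BBdry ms γ' (cl , n) → Sub ms γ' γ → Vec (Expr ms γ tm) n
           → Bdry ms γ cl
  metaBdry (bdry b) σ [] = subBdry σ b
  metaBdry (babs A bb) σ (t ∷ ts) = metaBdry bb (t ▸ σ) ts

  eqArgGoals : ∀ {ms γ' γ cl n} → BBdry ms γ' (cl , n) → Sub ms γ' γ
             → Vec (Expr ms γ tm) n → Vec (Expr ms γ tm) n → List (Goal ms γ)
  eqArgGoals (bdry b) σ [] [] = []
  eqArgGoals (babs A bb) σ (s ∷ ss) (t ∷ ts) =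
    J₀ (eqTerm s t (sub σ A)) ∷ eqArgGoals bb (s ▸ σ) ss ts

  bdryEqGoals : ∀ {ms γ c} → Bdry ms γ (obj c) → Bdry ms γ (obj c) → List (Goal ms γ)
  bdryEqGoals □type □type = []
  bdryEqGoals (□∶ C) (□∶ C') = J₀ (eqType C C') ∷ []

  instPrems : ∀ {ms γ sh} → MCtx sh → Inst ms γ sh → List (Goal ms γ)
  instPrems ∅ [] = []
  instPrems (Ξ ▷ bb) (e ∷ I) = jdg (fill (instBB I bb) e) ∷ instPrems Ξ I

  congPrems : ∀ {ms γ sh} → MCtx sh → Inst ms γ sh → Inst ms γ sh → List (Goal ms γ)
  congPrems ∅ [] [] = []
  congPrems (_▷_ {a = obj c , n} Ξ bb) (e ∷ I) (f ∷ J) = jdg (fillEq (instBB I bb) e f) ∷ congPrems Ξ I J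
  congPrems (_▷_ {a = eq c , n} Ξ bb) (e ∷ I) (f ∷ J) = congPrems Ξ I J

  IsObj : Class → Set
  IsObj (obj _) = ⊤
  IsObj (eq _) = ⊥

  congExtra : ∀ {ms γ sh cl} → Judg sh 0 cl → Inst ms γ sh → Inst ms γ sh → List (Goal ms γ)
  congExtra (isType A) I J = []
  congExtra (hasType t A) I J = J₀ (eqType (inst I A) (inst J A)) ∷ []
  congExtra (eqType A B) I J = []
  congExtra (eqTerm s t A) I J = []

  eqOf : Class → Class
  eqOf (obj c) = eq c
  eqOf (eq c) = eq c

  congConcl : ∀ {ms γ sh cl} → Judg sh 0 cl → IsObj cl → Inst ms γ sh → Inst ms γ sh → Judg ms γ (eqOf cl)
  congConcl (isType A) _ I J = eqType (inst I A) (inst J A)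
  congConcl (hasType t A) _ I J = eqTerm (inst I t) (inst J t) (inst I A)
  congConcl (eqType A B) () I J
  congConcl (eqTerm s t A) () I J

module _ {sig : Signature} (T : RawTheory {sig}) where
  open RawTheory T
  open RawRule

  data Der {ms : List Arity} (Θ : MCtx {sig} ms) : {γ : ℕ} → VCtx ms γ → Goal ms γ → Set where

    TT-Var : ∀ {γ} {Γ : VCtx ms γ} (i : Fin γ) → Der Θ Γ (J₀ (hasType (var i) (lookupTy Γ i)))

    TT-Meta : ∀ {γ} {Γ : VCtx ms γ} {cl n} (M : MVar ms (cl , n)) (ts : Vec (Expr ms γ tm) n)
      → All (Der Θ Γ) (metaArgGoals (lookupM Θ M) noVars ts)
      → Der Θ Γ (B₀ (metaBdry (lookupM Θ M) noVars ts))
      → Der Θ Γ (J₀ (fill₀ (metaBdry (lookupM Θ M) noVars ts) (mvHead M ts)))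

    TT-Meta-Congr : ∀ {γ} {Γ : VCtx ms γ} {c n} (M : MVar ms (obj c , n)) (ss ts : Vec (Expr ms γ tm) n)
      → All (Der Θ Γ) (metaArgGoals (lookupM Θ M) noVars ss)
      → All (Der Θ Γ) (metaArgGoals (lookupM Θ M) noVars ts)
      → All (Der Θ Γ) (eqArgGoals (lookupM Θ M) noVars ss ts)
      → Der Θ Γ (B₀ (metaBdry (lookupM Θ M) noVars ss))
      → Der Θ Γ (B₀ (metaBdry (lookupM Θ M) noVars ts))
      → All (Der Θ Γ) (bdryEqGoals (metaBdry (lookupM Θ M) noVars ss) (metaBdry (lookupM Θ M) noVars ts))
      → Der Θ Γ (J₀ (fillEq₀ (metaBdry (lookupM Θ M) noVars ss) (mv M ss) (mv M ts)))

    TT-Abstr : ∀ {γ} {Γ : VCtx ms γ} {A a} {j : JJudg ms (suc γ) a}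
      → Der Θ Γ (J₀ (isType A)) → Der Θ (Γ ▷ A) (jdg j) → Der Θ Γ (jdg (jabs A j))

    TT-EqTy-Refl : ∀ {γ} {Γ : VCtx ms γ} {A}
      → Der Θ Γ (J₀ (isType A)) → Der Θ Γ (J₀ (eqType A A))
    TT-EqTy-Sym : ∀ {γ} {Γ : VCtx ms γ} {A B}
      → Der Θ Γ (J₀ (eqType A B)) → Der Θ Γ (J₀ (eqType B A))
    TT-EqTy-Trans : ∀ {γ} {Γ : VCtx ms γ} {A B C}
      → Der Θ Γ (J₀ (eqType A B)) → Der Θ Γ (J₀ (eqType B C)) → Der Θ Γ (J₀ (eqType A C))
    TT-EqTm-Refl : ∀ {γ} {Γ : VCtx ms γ} {t A}
      → Der Θ Γ (J₀ (hasType t A)) → Der Θ Γ (J₀ (eqTerm t t A))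
    TT-EqTm-Sym : ∀ {γ} {Γ : VCtx ms γ} {s t A}
      → Der Θ Γ (J₀ (eqTerm s t A)) → Der Θ Γ (J₀ (eqTerm t s A))
    TT-EqTm-Trans : ∀ {γ} {Γ : VCtx ms γ} {r s t A}
      → Der Θ Γ (J₀ (eqTerm r s A)) → Der Θ Γ (J₀ (eqTerm s t A)) → Der Θ Γ (J₀ (eqTerm r t A))
    TT-Conv-Tm : ∀ {γ} {Γ : VCtx ms γ} {t A B}
      → Der Θ Γ (J₀ (hasType t A)) → Der Θ Γ (J₀ (eqType A B)) → Der Θ Γ (J₀ (hasType t B))
    TT-Conv-EqTm : ∀ {γ} {Γ : VCtx ms γ} {s t A B}
      → Der Θ Γ (J₀ (eqTerm s t A)) → Der Θ Γ (J₀ (eqType A B)) → Der Θ Γ (J₀ (eqTerm s t B))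

    TT-Bdry-Ty : ∀ {γ} {Γ : VCtx ms γ} → Der Θ Γ (B₀ □type)
    TT-Bdry-Tm : ∀ {γ} {Γ : VCtx ms γ} {A}
      → Der Θ Γ (J₀ (isType A)) → Der Θ Γ (B₀ (□∶ A))
    TT-Bdry-EqTy : ∀ {γ} {Γ : VCtx ms γ} {A B}
      → Der Θ Γ (J₀ (isType A)) → Der Θ Γ (J₀ (isType B)) → Der Θ Γ (B₀ (A ≡ B by□))
    TT-Bdry-EqTm : ∀ {γ} {Γ : VCtx ms γ} {s t A}
      → Der Θ Γ (J₀ (isType A)) → Der Θ Γ (J₀ (hasType s A)) → Der Θ Γ (J₀ (hasType t A))
      → Der Θ Γ (B₀ (s ≡ t ∶ A by□))
    TT-Bdry-Abstr : ∀ {γ} {Γ : VCtx ms γ} {A a} {bb : BBdry ms (suc γ) a}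
      → Der Θ Γ (J₀ (isType A)) → Der Θ (Γ ▷ A) (bdy bb) → Der Θ Γ (bdy (babs A bb))

    TT-Specific : ∀ {γ} {Γ : VCtx ms γ} (r : Rule) (I : Inst {sig} ms γ (shape (rule r)))
      → All (Der Θ Γ) (instPrems (premises (rule r)) I)
      → Der Θ Γ (B₀ (instBdry I (bdryOf (conclusion (rule r)))))
      → Der Θ Γ (J₀ (instJudg I (conclusion (rule r))))

    TT-Congr : ∀ {γ} {Γ : VCtx ms γ} (r : Rule) (o : IsObj {sig} (conclClass (rule r)))
      (I J : Inst {sig} ms γ (shape (rule r)))
      → All (Der Θ Γ) (instPrems (premises (rule r)) I)
      → All (Der Θ Γ) (instPrems (premises (rule r)) J)
      → All (Der Θ Γ) (congPrems (premises (rule r)) I J)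
      → Der Θ Γ (B₀ (instBdry I (bdryOf (conclusion (rule r)))))
      → Der Θ Γ (B₀ (instBdry J (bdryOf (conclusion (rule r)))))
      → All (Der Θ Γ) (congExtra (conclusion (rule r)) I J)
      → Der Θ Γ (J₀ (congConcl (conclusion (rule r)) o I J))

  DerivableInst : ∀ {ms γ sh} → MCtx {sig} ms → VCtx ms γ → MCtx sh → Inst {sig} ms γ sh → Set
  DerivableInst Θ Γ Ξ I = All (Der Θ Γ) (instPrems Ξ I)

  ⊢_mctx : ∀ {ms} → MCtx {sig} ms → Set
  ⊢ ∅ mctx = ⊤
  ⊢ (Ξ ▷ bb) mctx = (⊢ Ξ mctx) × Der Ξ ∅ (bdy bb)

-- A generic application M̂ is derivable as soon as the boundary of M is: under the
-- abstractions of that boundary it is M applied to the bound variables, an instance of the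
-- metavariable rule.  Hence, by induction on k, the entries before M_k form the generic
-- instantiation of Ξ_(k) over itself, and each entry after it is a generic application over
-- Ξ[M_k ↦ e], whose boundary (⟨Ξ;M_k ↦ e⟩_(j))_* BB_j is derivable because instantiation is
-- admissible.  Admissibility of instantiation in turn rests on admissibility of substitution,
-- to apply an instantiated argument to the arguments of a metavariable, and of equality
-- substitution, for the congruence rule of a metavariable.

module Submission where

open import Defs
open import Data.Nat using (ℕ; zero; suc; _+_)
open import Data.Fin using (Fin; zero; suc; _↑ˡ_; _↑ʳ_)
open import Data.Vec using (Vec; []; _∷_)
open import Data.List using (List; []; _∷_; map)
open import Data.List.Relation.Unary.All using (All; []; _∷_)
open import Data.Product using (_×_; _,_)
open import Function using (id; _∘_)
open import Data.Unit using (⊤; tt)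
open import Relation.Binary.PropositionalEquality
  using (_≡_; refl; trans; cong; cong₂; subst; _≗_; module ≡-Reasoning) renaming (sym to ≡sym)
open ≡-Reasoning

cong₃ : ∀ {A B C D : Set} (f : A → B → C → D) {x y z x′ y′ z′}
      → x ≡ x′ → y ≡ y′ → z ≡ z′ → f x y z ≡ f x′ y′ z′
cong₃ f refl refl refl = refl

module _ {sig : Signature} where

  private variable
    ms ps ns sh : List Arity
    γ δ ε : ℕ
    c : OC
    cl : Class
    a b : Arity
    as : List Arity
    n : ℕ

  private
    Terms : List Arity → ℕ → ℕ → Set
    Terms ms γ n = Vec (Expr {sig} ms γ tm) n

  varSub : Ren {sig} γ δ → Sub {sig} ms γ δ
  varSub ρ = var ∘ ρ

  sub-cong     : {σ σ′ : Sub {sig} ms γ δ} → σ ≗ σ′ → (x : Expr {sig} ms γ c) → sub σ x ≡ sub σ′ x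
  subVec-cong  : {σ σ′ : Sub {sig} ms γ δ} → σ ≗ σ′ → (x : Terms ms γ n) → subVec σ x ≡ subVec σ′ x
  subArg-cong  : {σ σ′ : Sub {sig} ms γ δ} → σ ≗ σ′ → (x : Arg {sig} ms γ a) → subArg σ x ≡ subArg σ′ x
  subArgs-cong : {σ σ′ : Sub {sig} ms γ δ} → σ ≗ σ′ → (x : Args {sig} ms γ as) → subArgs σ x ≡ subArgs σ′ x
  sub-cong p (var i) = p i
  sub-cong p (sym S es) = cong (sym S) (subArgs-cong p es)
  sub-cong p (mv M ts) = cong (mv M) (subVec-cong p ts)
  subVec-cong p [] = refl
  subVec-cong p (t ∷ ts) = cong₂ _∷_ (sub-cong p t) (subVec-cong p ts)
  subArg-cong p (expr e) = cong expr (sub-cong p e)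
  subArg-cong p ⋆ = refl
  subArg-cong p (abs e) = cong abs (subArg-cong (λ { zero → refl ; (suc i) → cong (ren suc) (p i) }) e)
  subArgs-cong p [] = refl
  subArgs-cong p (e ∷ es) = cong₂ _∷_ (subArg-cong p e) (subArgs-cong p es)

  sub-id     : {σ : Sub {sig} ms γ γ} → σ ≗ var → (x : Expr {sig} ms γ c) → sub σ x ≡ x
  subVec-id  : {σ : Sub {sig} ms γ γ} → σ ≗ var → (x : Terms ms γ n) → subVec σ x ≡ x
  subArg-id  : {σ : Sub {sig} ms γ γ} → σ ≗ var → (x : Arg {sig} ms γ a) → subArg σ x ≡ x
  subArgs-id : {σ : Sub {sig} ms γ γ} → σ ≗ var → (x : Args {sig} ms γ as) → subArgs σ x ≡ x
  sub-id p (var i) = p i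
  sub-id p (sym S es) = cong (sym S) (subArgs-id p es)
  sub-id p (mv M ts) = cong (mv M) (subVec-id p ts)
  subVec-id p [] = refl
  subVec-id p (t ∷ ts) = cong₂ _∷_ (sub-id p t) (subVec-id p ts)
  subArg-id p (expr e) = cong expr (sub-id p e)
  subArg-id p ⋆ = refl
  subArg-id p (abs e) = cong abs (subArg-id (λ { zero → refl ; (suc i) → cong (ren suc) (p i) }) e)
  subArgs-id p [] = refl
  subArgs-id p (e ∷ es) = cong₂ _∷_ (subArg-id p e) (subArgs-id p es)

  ren≡sub         : (ρ : Ren {sig} γ δ) (x : Expr {sig} ms γ c) → ren ρ x ≡ sub (varSub ρ) x
  renVec≡subVec   : (ρ : Ren {sig} γ δ) (x : Terms ms γ n) → renVec ρ x ≡ subVec (varSub ρ) x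
  renArg≡subArg   : (ρ : Ren {sig} γ δ) (x : Arg {sig} ms γ a) → renArg ρ x ≡ subArg (varSub ρ) x
  renArgs≡subArgs : (ρ : Ren {sig} γ δ) (x : Args {sig} ms γ as) → renArgs ρ x ≡ subArgs (varSub ρ) x
  ren≡sub ρ (var i) = refl
  ren≡sub ρ (sym S es) = cong (sym S) (renArgs≡subArgs ρ es)
  ren≡sub ρ (mv M ts) = cong (mv M) (renVec≡subVec ρ ts)
  renVec≡subVec ρ [] = refl
  renVec≡subVec ρ (t ∷ ts) = cong₂ _∷_ (ren≡sub ρ t) (renVec≡subVec ρ ts)
  renArg≡subArg ρ (expr e) = cong expr (ren≡sub ρ e)
  renArg≡subArg ρ ⋆ = refl
  renArg≡subArg ρ (abs e) =
    cong abs (trans (renArg≡subArg (liftR ρ) e) (subArg-cong (λ { zero → refl ; (suc i) → refl }) e))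
  renArgs≡subArgs ρ [] = refl
  renArgs≡subArgs ρ (e ∷ es) = cong₂ _∷_ (renArg≡subArg ρ e) (renArgs≡subArgs ρ es)

  sub-ren         : {σ : Sub {sig} ms δ ε} {ρ : Ren {sig} γ δ} {θ : Sub {sig} ms γ ε}
                  → σ ∘ ρ ≗ θ → (x : Expr {sig} ms γ c) → sub σ (ren ρ x) ≡ sub θ x
  subVec-renVec   : {σ : Sub {sig} ms δ ε} {ρ : Ren {sig} γ δ} {θ : Sub {sig} ms γ ε}
                  → σ ∘ ρ ≗ θ → (x : Terms ms γ n) → subVec σ (renVec ρ x) ≡ subVec θ x
  subArg-renArg   : {σ : Sub {sig} ms δ ε} {ρ : Ren {sig} γ δ} {θ : Sub {sig} ms γ ε}
                  → σ ∘ ρ ≗ θ → (x : Arg {sig} ms γ a) → subArg σ (renArg ρ x) ≡ subArg θ x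
  subArgs-renArgs : {σ : Sub {sig} ms δ ε} {ρ : Ren {sig} γ δ} {θ : Sub {sig} ms γ ε}
                  → σ ∘ ρ ≗ θ → (x : Args {sig} ms γ as) → subArgs σ (renArgs ρ x) ≡ subArgs θ x
  sub-ren p (var i) = p i
  sub-ren p (sym S es) = cong (sym S) (subArgs-renArgs p es)
  sub-ren p (mv M ts) = cong (mv M) (subVec-renVec p ts)
  subVec-renVec p [] = refl
  subVec-renVec p (t ∷ ts) = cong₂ _∷_ (sub-ren p t) (subVec-renVec p ts)
  subArg-renArg p (expr e) = cong expr (sub-ren p e)
  subArg-renArg p ⋆ = refl
  subArg-renArg p (abs e) = cong abs (subArg-renArg (λ { zero → refl ; (suc i) → cong (ren suc) (p i) }) e)
  subArgs-renArgs p [] = refl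
  subArgs-renArgs p (e ∷ es) = cong₂ _∷_ (subArg-renArg p e) (subArgs-renArgs p es)

  ren-ren : {ρ : Ren {sig} δ ε} {ρ′ : Ren {sig} γ δ} {θ : Ren {sig} γ ε}
          → ρ ∘ ρ′ ≗ θ → (x : Expr {sig} ms γ c) → ren ρ (ren ρ′ x) ≡ ren θ x
  ren-ren {ρ = ρ} {ρ′} {θ} p x = begin
    ren ρ (ren ρ′ x)          ≡⟨ ren≡sub ρ (ren ρ′ x) ⟩
    sub (varSub ρ) (ren ρ′ x) ≡⟨ sub-ren (cong var ∘ p) x ⟩
    sub (varSub θ) x          ≡⟨ ren≡sub θ x ⟨
    ren θ x                   ∎

  ren-id : {ρ : Ren {sig} γ γ} → ρ ≗ id → (x : Expr {sig} ms γ c) → ren ρ x ≡ x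
  ren-id {ρ = ρ} p x = trans (ren≡sub ρ x) (sub-id (cong var ∘ p) x)

  ren-suc-liftR : (ρ : Ren {sig} γ δ) (x : Expr {sig} ms γ c) → ren (liftR {sig} ρ) (ren suc x) ≡ ren suc (ren ρ x)
  ren-suc-liftR ρ x = trans (ren-ren (λ _ → refl) x) (≡sym (ren-ren (λ _ → refl) x))

  ren-sub         : {ρ : Ren {sig} δ ε} {σ : Sub {sig} ms γ δ} {θ : Sub {sig} ms γ ε}
                  → ren ρ ∘ σ ≗ θ → (x : Expr {sig} ms γ c) → ren ρ (sub σ x) ≡ sub θ x
  renVec-subVec   : {ρ : Ren {sig} δ ε} {σ : Sub {sig} ms γ δ} {θ : Sub {sig} ms γ ε}
                  → ren ρ ∘ σ ≗ θ → (x : Terms ms γ n) → renVec ρ (subVec σ x) ≡ subVec θ x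
  renArg-subArg   : {ρ : Ren {sig} δ ε} {σ : Sub {sig} ms γ δ} {θ : Sub {sig} ms γ ε}
                  → ren ρ ∘ σ ≗ θ → (x : Arg {sig} ms γ a) → renArg ρ (subArg σ x) ≡ subArg θ x
  renArgs-subArgs : {ρ : Ren {sig} δ ε} {σ : Sub {sig} ms γ δ} {θ : Sub {sig} ms γ ε}
                  → ren ρ ∘ σ ≗ θ → (x : Args {sig} ms γ as) → renArgs ρ (subArgs σ x) ≡ subArgs θ x
  ren-sub p (var i) = p i
  ren-sub p (sym S es) = cong (sym S) (renArgs-subArgs p es)
  ren-sub p (mv M ts) = cong (mv M) (renVec-subVec p ts)
  renVec-subVec p [] = refl
  renVec-subVec p (t ∷ ts) = cong₂ _∷_ (ren-sub p t) (renVec-subVec p ts)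
  renArg-subArg p (expr e) = cong expr (ren-sub p e)
  renArg-subArg p ⋆ = refl
  renArg-subArg {ρ = ρ} {σ} p (abs e) = cong abs (renArg-subArg lifted e)
    where
    lifted : ren (liftR {sig} ρ) ∘ liftS σ ≗ liftS _
    lifted zero = refl
    lifted (suc i) = trans (ren-suc-liftR ρ (σ i)) (cong (ren suc) (p i))
  renArgs-subArgs p [] = refl
  renArgs-subArgs p (e ∷ es) = cong₂ _∷_ (renArg-subArg p e) (renArgs-subArgs p es)

  liftS-ren-suc : (σ : Sub {sig} ms γ δ) (x : Expr {sig} ms γ c) → sub (liftS σ) (ren suc x) ≡ ren suc (sub σ x)
  liftS-ren-suc σ x = trans (sub-ren (λ _ → refl) x) (≡sym (ren-sub (λ _ → refl) x))

  sub-sub         : {τ : Sub {sig} ms δ ε} {σ : Sub {sig} ms γ δ} {θ : Sub {sig} ms γ ε}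
                  → sub τ ∘ σ ≗ θ → (x : Expr {sig} ms γ c) → sub τ (sub σ x) ≡ sub θ x
  subVec-subVec   : {τ : Sub {sig} ms δ ε} {σ : Sub {sig} ms γ δ} {θ : Sub {sig} ms γ ε}
                  → sub τ ∘ σ ≗ θ → (x : Terms ms γ n) → subVec τ (subVec σ x) ≡ subVec θ x
  subArg-subArg   : {τ : Sub {sig} ms δ ε} {σ : Sub {sig} ms γ δ} {θ : Sub {sig} ms γ ε}
                  → sub τ ∘ σ ≗ θ → (x : Arg {sig} ms γ a) → subArg τ (subArg σ x) ≡ subArg θ x
  subArgs-subArgs : {τ : Sub {sig} ms δ ε} {σ : Sub {sig} ms γ δ} {θ : Sub {sig} ms γ ε}
                  → sub τ ∘ σ ≗ θ → (x : Args {sig} ms γ as) → subArgs τ (subArgs σ x) ≡ subArgs θ x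
  sub-sub p (var i) = p i
  sub-sub p (sym S es) = cong (sym S) (subArgs-subArgs p es)
  sub-sub p (mv M ts) = cong (mv M) (subVec-subVec p ts)
  subVec-subVec p [] = refl
  subVec-subVec p (t ∷ ts) = cong₂ _∷_ (sub-sub p t) (subVec-subVec p ts)
  subArg-subArg p (expr e) = cong expr (sub-sub p e)
  subArg-subArg p ⋆ = refl
  subArg-subArg {τ = τ} {σ} p (abs e) = cong abs (subArg-subArg lifted e)
    where
    lifted : sub (liftS τ) ∘ liftS σ ≗ liftS _
    lifted zero = refl
    lifted (suc i) = trans (liftS-ren-suc τ (σ i)) (cong (ren suc) (p i))
  subArgs-subArgs p [] = refl
  subArgs-subArgs p (e ∷ es) = cong₂ _∷_ (subArg-subArg p e) (subArgs-subArgs p es)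

  ▸-cong : {σ σ′ : Sub {sig} ms γ δ} → σ ≗ σ′ → (t : Expr {sig} ms δ tm) → (t ▸ σ) ≗ (t ▸ σ′)
  ▸-cong p t zero = refl
  ▸-cong p t (suc i) = p i

  sub-▸ : {τ : Sub {sig} ms δ ε} {σ : Sub {sig} ms γ δ} {θ : Sub {sig} ms γ ε}
        → sub τ ∘ σ ≗ θ → (t : Expr {sig} ms δ tm) → sub τ ∘ (t ▸ σ) ≗ (sub τ t ▸ θ)
  sub-▸ p t zero = refl
  sub-▸ p t (suc i) = p i

  sub-noVars : {σ : Sub {sig} ms γ δ} → sub σ ∘ noVars {sig} {ms} {γ} ≗ noVars
  sub-noVars ()

  apply-cong : {σ σ′ : Sub {sig} ms γ δ} → σ ≗ σ′
             → (e : Arg {sig} ms γ (obj c , n)) (us : Terms ms δ n) → apply e σ us ≡ apply e σ′ us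
  apply-cong p (expr e) [] = sub-cong p e
  apply-cong p (abs e) (u ∷ us) = apply-cong (▸-cong p u) e us

  sub-apply : {τ : Sub {sig} ms δ ε} {σ : Sub {sig} ms γ δ} {θ : Sub {sig} ms γ ε} → sub τ ∘ σ ≗ θ
            → (e : Arg {sig} ms γ (obj c , n)) (us : Terms ms δ n) → sub τ (apply e σ us) ≡ apply e θ (subVec τ us)
  sub-apply p (expr e) [] = sub-sub p e
  sub-apply p (abs e) (u ∷ us) = sub-apply (sub-▸ p u) e us

  apply-subArg : {τ : Sub {sig} ms δ ε} {σ : Sub {sig} ms γ δ} {θ : Sub {sig} ms γ ε} → sub τ ∘ σ ≗ θ
               → (e : Arg {sig} ms γ (obj c , n)) (us : Terms ms ε n) → apply (subArg σ e) τ us ≡ apply e θ us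
  apply-subArg p (expr e) [] = sub-sub p e
  apply-subArg {σ = σ} p (abs e) (u ∷ us) = apply-subArg lifted e us
    where
    lifted : sub (u ▸ _) ∘ liftS σ ≗ (u ▸ _)
    lifted zero = refl
    lifted (suc i) = trans (sub-ren (λ _ → refl) (σ i)) (p i)

  subInst : Sub {sig} ms γ δ → Inst {sig} ms γ sh → Inst {sig} ms δ sh
  subInst σ [] = []
  subInst σ (e ∷ I) = subArg σ e ∷ subInst σ I

  lookupI-subInst : (σ : Sub {sig} ms γ δ) (I : Inst {sig} ms γ sh) (M : MVar sh a)
                  → lookupI (subInst σ I) M ≡ subArg σ (lookupI I M)
  lookupI-subInst σ (e ∷ I) here = refl
  lookupI-subInst σ (e ∷ I) (there M) = lookupI-subInst σ I M

  module _ (σ : Sub {sig} ms γ δ) (I : Inst {sig} ms γ sh) where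
    -- The variables of an instantiated expression are its own d bound variables followed by the γ
    -- variables of the instantiation; τ acts on them as σ lifted past the bound ones.
    IsLift : (d : ℕ) → Sub {sig} ms (d + γ) (d + δ) → Set
    IsLift d τ = (∀ i → τ (i ↑ˡ γ) ≡ var (i ↑ˡ δ)) × (∀ j → τ (d ↑ʳ j) ≡ ren (d ↑ʳ_) (σ j))

    IsLift-zero : IsLift 0 σ
    IsLift-zero = (λ ()) , (λ j → ≡sym (ren-id (λ _ → refl) (σ j)))

    IsLift-suc : {d : ℕ} {τ : Sub {sig} ms (d + γ) (d + δ)} → IsLift d τ → IsLift (suc d) (liftS τ)
    IsLift-suc (bound , outer) =
      (λ { zero → refl ; (suc i) → cong (ren suc) (bound i) }) ,
      (λ j → trans (cong (ren suc) (outer j)) (ren-ren (λ _ → refl) (σ j)))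

    sub-inst         : {d : ℕ} {τ : Sub {sig} ms (d + γ) (d + δ)} → IsLift d τ
                     → (x : Expr {sig} sh d c) → sub τ (inst I x) ≡ inst (subInst σ I) x
    subVec-instVec   : {d : ℕ} {τ : Sub {sig} ms (d + γ) (d + δ)} → IsLift d τ
                     → (x : Terms sh d n) → subVec τ (instVec I x) ≡ instVec (subInst σ I) x
    subArg-instArg   : {d : ℕ} {τ : Sub {sig} ms (d + γ) (d + δ)} → IsLift d τ
                     → (x : Arg {sig} sh d a) → subArg τ (instArg I x) ≡ instArg (subInst σ I) x
    subArgs-instArgs : {d : ℕ} {τ : Sub {sig} ms (d + γ) (d + δ)} → IsLift d τ
                     → (x : Args {sig} sh d as) → subArgs τ (instArgs I x) ≡ instArgs (subInst σ I) x
    sub-inst (bound , _) (var i) = bound i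
    sub-inst lift (sym S es) = cong (sym S) (subArgs-instArgs lift es)
    sub-inst {d = d} lift@(_ , outer) (mv M ts) = begin
      sub _ (apply (lookupI I M) _ (instVec I ts))
        ≡⟨ sub-apply (λ _ → refl) (lookupI I M) (instVec I ts) ⟩
      apply (lookupI I M) _ (subVec _ (instVec I ts))
        ≡⟨ cong (apply (lookupI I M) _) (subVec-instVec lift ts) ⟩
      apply (lookupI I M) _ (instVec (subInst σ I) ts)
        ≡⟨ apply-subArg outer′ (lookupI I M) _ ⟨
      apply (subArg σ (lookupI I M)) _ (instVec (subInst σ I) ts)
        ≡⟨ cong (λ u → apply u _ _) (lookupI-subInst σ I M) ⟨
      apply (lookupI (subInst σ I) M) _ (instVec (subInst σ I) ts) ∎
      where
      outer′ : sub (var ∘ (d ↑ʳ_)) ∘ σ ≗ _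
      outer′ j = trans (≡sym (ren≡sub (d ↑ʳ_) (σ j))) (≡sym (outer j))
    subVec-instVec lift [] = refl
    subVec-instVec lift (t ∷ ts) = cong₂ _∷_ (sub-inst lift t) (subVec-instVec lift ts)
    subArg-instArg lift (expr e) = cong expr (sub-inst lift e)
    subArg-instArg lift ⋆ = refl
    subArg-instArg lift (abs e) = cong abs (subArg-instArg (IsLift-suc lift) e)
    subArgs-instArgs lift [] = refl
    subArgs-instArgs lift (e ∷ es) = cong₂ _∷_ (subArg-instArg lift e) (subArgs-instArgs lift es)

    sub-inst₀ : (x : Expr {sig} sh 0 c) → sub σ (inst I x) ≡ inst (subInst σ I) x
    sub-inst₀ = sub-inst IsLift-zero

  applyArg : Arg {sig} ps γ (cl , n) → Sub {sig} ps γ δ → Terms ps δ n → Arg {sig} ps δ (cl , 0)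
  applyArg (expr e) σ [] = expr (sub σ e)
  applyArg ⋆ σ [] = ⋆
  applyArg (abs e) σ (u ∷ us) = applyArg e (u ▸ σ) us

  applyArg-obj : (e : Arg {sig} ps γ (obj c , n)) (σ : Sub {sig} ps γ δ) (us : Terms ps δ n)
               → applyArg e σ us ≡ expr (apply e σ us)
  applyArg-obj (expr e) σ [] = refl
  applyArg-obj (abs e) σ (u ∷ us) = applyArg-obj e (u ▸ σ) us

  applyArg-eq : (e : Arg {sig} ps γ (eq c , n)) (σ : Sub {sig} ps γ δ) (us : Terms ps δ n) → applyArg e σ us ≡ ⋆
  applyArg-eq ⋆ σ [] = refl
  applyArg-eq (abs e) σ (u ∷ us) = applyArg-eq e (u ▸ σ) us

  applyArg-[] : (e : Arg {sig} ps γ (cl , 0)) (σ : Sub {sig} ps γ δ) → applyArg e σ [] ≡ subArg σ e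
  applyArg-[] (expr e) σ = refl
  applyArg-[] ⋆ σ = refl

  subArg-mvHead : (M : MVar ms (cl , n)) (σ : Sub {sig} ms γ δ) (ts : Terms ms γ n)
                → subArg σ (mvHead M ts) ≡ mvHead M (subVec σ ts)
  subArg-mvHead {cl = obj c} M σ ts = refl
  subArg-mvHead {cl = eq c} M σ ts = refl

  -- hatGo builds its body from a renaming of the scope; K is the same body as a function of a
  -- substitution, and naturality says that substituting into the body only acts through K.
  NaturalHead : (∀ {δ} → Ren {sig} γ δ → Terms ms δ n → Arg {sig} ms δ (cl , 0))
              → (∀ {δ} → Sub {sig} ms γ δ → Terms ms δ n → Arg {sig} ms δ (cl , 0)) → Set
  NaturalHead {γ = γ} {ms} {n} k K = ∀ {δ ε} (ρ : Ren {sig} γ δ) (τ : Sub {sig} ms δ ε) (ts : Terms ms δ n)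
                                   → subArg τ (k ρ ts) ≡ K (τ ∘ ρ) (subVec τ ts)

  applyArg-hatGo : ∀ r (k : ∀ {δ} → Ren {sig} γ δ → Terms ms δ r → Arg {sig} ms δ (cl , 0))
                   (K : ∀ {δ} → Sub {sig} ms γ δ → Terms ms δ r → Arg {sig} ms δ (cl , 0))
                 → NaturalHead k K
                 → (σ : Sub {sig} ms γ δ) (us : Terms ms δ r) → applyArg (hatGo cl r k) σ us ≡ K σ us
  applyArg-hatGo zero k K natural σ [] = trans (applyArg-[] (k id []) σ) (natural id σ [])
  applyArg-hatGo (suc r) k K natural σ (u ∷ us) =
    applyArg-hatGo r (λ ρ ts → k (ρ ∘ suc) (var (ρ zero) ∷ ts)) (λ θ ts → K (θ ∘ suc) (θ zero ∷ ts))
      (λ ρ τ ts → natural (ρ ∘ suc) τ (var (ρ zero) ∷ ts)) (u ▸ σ) us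

  applyArg-hat : (M : MVar ms (cl , n)) (σ : Sub {sig} ms 0 δ) (us : Terms ms δ n) → applyArg (hat M) σ us ≡ mvHead M us
  applyArg-hat {n = n} M =
    applyArg-hatGo n (λ _ ts → mvHead M ts) (λ _ ts → mvHead M ts) (λ _ τ ts → subArg-mvHead M τ ts)

  expr-injective : {x y : Expr {sig} ms γ c} → expr {sig} x ≡ expr y → x ≡ y
  expr-injective refl = refl

  apply-hat : (M : MVar ms (obj c , n)) (σ : Sub {sig} ms 0 δ) (us : Terms ms δ n) → apply (hat M) σ us ≡ mv M us
  apply-hat M σ us = expr-injective (trans (≡sym (applyArg-obj (hat M) σ us)) (applyArg-hat M σ us))

  mrenArg-hatGo : ∀ r (μ : MRen {sig} ms ps) (k : ∀ {δ} → Ren {sig} γ δ → Terms ms δ r → Arg {sig} ms δ (cl , 0))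
                  (k′ : ∀ {δ} → Ren {sig} γ δ → Terms ps δ r → Arg {sig} ps δ (cl , 0))
                → (∀ {δ} (ρ : Ren {sig} γ δ) ts → mrenArg μ (k ρ ts) ≡ k′ ρ (mrenVec μ ts))
                → mrenArg μ (hatGo cl r k) ≡ hatGo cl r k′
  mrenArg-hatGo zero μ k k′ p = p id []
  mrenArg-hatGo (suc r) μ k k′ p = cong abs (mrenArg-hatGo r μ _ _ (λ ρ ts → p (ρ ∘ suc) (var (ρ zero) ∷ ts)))

  mrenArg-mvHead : (μ : MRen {sig} ms ps) (M : MVar ms (cl , n)) (ts : Terms ms γ n)
                 → mrenArg μ (mvHead M ts) ≡ mvHead (μ M) (mrenVec μ ts)
  mrenArg-mvHead {cl = obj c} μ M ts = refl
  mrenArg-mvHead {cl = eq c} μ M ts = refl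

  mrenArg-hat : (μ : MRen {sig} ms ps) (M : MVar ms (cl , n)) → mrenArg μ (hat M) ≡ hat (μ M)
  mrenArg-hat {n = n} μ M = mrenArg-hatGo n μ _ _ (λ _ ts → mrenArg-mvHead μ M ts)

  lookupI-wkInst : (I : Inst {sig} ps γ sh) (M : MVar sh a) → lookupI (wkInst {b = b} I) M ≡ mrenArg there (lookupI I M)
  lookupI-wkInst (e ∷ I) here = refl
  lookupI-wkInst (e ∷ I) (there M) = lookupI-wkInst I M

  lookupI-genInst : ∀ ms (M : MVar ms a) → lookupI (genInst {sig} ms) M ≡ hat M
  lookupI-genInst (b ∷ ms) here = refl
  lookupI-genInst (b ∷ ms) (there M) = begin
    lookupI (wkInst (genInst ms)) M       ≡⟨ lookupI-wkInst (genInst ms) M ⟩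
    mrenArg there (lookupI (genInst ms) M) ≡⟨ cong (mrenArg there) (lookupI-genInst ms M) ⟩
    mrenArg there (hat M)                  ≡⟨ mrenArg-hat there M ⟩
    hat (there M)                          ∎

  -- φ M ts is what M(ts) becomes; both metavariable renamings and instantiations are of this form.
  MSub : List Arity → List Arity → Set
  MSub ms ps = ∀ {γ c n} → MVar ms (obj c , n) → Terms ps γ n → Expr {sig} ps γ c

  record CommutesWithSub (φ : MSub ms ps) : Set where
    field
      commute : ∀ {γ δ c n} (M : MVar ms (obj c , n)) (σ : Sub {sig} ps γ δ) (ts : Terms ps γ n)
              → φ M (subVec σ ts) ≡ sub σ (φ M ts)
  open CommutesWithSub

  msub     : MSub ms ps → Expr {sig} ms γ c → Expr {sig} ps γ c
  msubVec  : MSub ms ps → Terms ms γ n → Terms ps γ n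
  msubArg  : MSub ms ps → Arg {sig} ms γ a → Arg {sig} ps γ a
  msubArgs : MSub ms ps → Args {sig} ms γ as → Args {sig} ps γ as
  msub φ (var i) = var i
  msub φ (sym S es) = sym S (msubArgs φ es)
  msub φ (mv M ts) = φ M (msubVec φ ts)
  msubVec φ [] = []
  msubVec φ (t ∷ ts) = msub φ t ∷ msubVec φ ts
  msubArg φ (expr e) = expr (msub φ e)
  msubArg φ ⋆ = ⋆
  msubArg φ (abs e) = abs (msubArg φ e)
  msubArgs φ [] = []
  msubArgs φ (e ∷ es) = msubArg φ e ∷ msubArgs φ es

  msubInst : MSub ms ps → Inst {sig} ms γ sh → Inst {sig} ps γ sh
  msubInst φ [] = []
  msubInst φ (e ∷ I) = msubArg φ e ∷ msubInst φ I

  lookupI-msubInst : (φ : MSub ms ps) (I : Inst {sig} ms γ sh) (M : MVar sh a)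
                   → lookupI (msubInst φ I) M ≡ msubArg φ (lookupI I M)
  lookupI-msubInst φ (e ∷ I) here = refl
  lookupI-msubInst φ (e ∷ I) (there M) = lookupI-msubInst φ I M

  module _ {φ : MSub ms ps} (φ-sub : CommutesWithSub φ) where
    msub-ren         : (ρ : Ren {sig} γ δ) (x : Expr {sig} ms γ c) → msub φ (ren ρ x) ≡ ren ρ (msub φ x)
    msubVec-renVec   : (ρ : Ren {sig} γ δ) (x : Terms ms γ n) → msubVec φ (renVec ρ x) ≡ renVec ρ (msubVec φ x)
    msubArg-renArg   : (ρ : Ren {sig} γ δ) (x : Arg {sig} ms γ a) → msubArg φ (renArg ρ x) ≡ renArg ρ (msubArg φ x)
    msubArgs-renArgs : (ρ : Ren {sig} γ δ) (x : Args {sig} ms γ as)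
                     → msubArgs φ (renArgs ρ x) ≡ renArgs ρ (msubArgs φ x)
    msub-ren ρ (var i) = refl
    msub-ren ρ (sym S es) = cong (sym S) (msubArgs-renArgs ρ es)
    msub-ren ρ (mv M ts) = begin
      φ M (msubVec φ (renVec ρ ts))          ≡⟨ cong (φ M) (msubVec-renVec ρ ts) ⟩
      φ M (renVec ρ (msubVec φ ts))          ≡⟨ cong (φ M) (renVec≡subVec ρ (msubVec φ ts)) ⟩
      φ M (subVec (varSub ρ) (msubVec φ ts)) ≡⟨ commute φ-sub M (varSub ρ) (msubVec φ ts) ⟩
      sub (varSub ρ) (φ M (msubVec φ ts))    ≡⟨ ren≡sub ρ _ ⟨
      ren ρ (φ M (msubVec φ ts))             ∎
    msubVec-renVec ρ [] = refl
    msubVec-renVec ρ (t ∷ ts) = cong₂ _∷_ (msub-ren ρ t) (msubVec-renVec ρ ts)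
    msubArg-renArg ρ (expr e) = cong expr (msub-ren ρ e)
    msubArg-renArg ρ ⋆ = refl
    msubArg-renArg ρ (abs e) = cong abs (msubArg-renArg (liftR ρ) e)
    msubArgs-renArgs ρ [] = refl
    msubArgs-renArgs ρ (e ∷ es) = cong₂ _∷_ (msubArg-renArg ρ e) (msubArgs-renArgs ρ es)

    msub-sub         : {σ : Sub {sig} ms γ δ} {θ : Sub {sig} ps γ δ} → msub φ ∘ σ ≗ θ
                     → (x : Expr {sig} ms γ c) → msub φ (sub σ x) ≡ sub θ (msub φ x)
    msubVec-subVec   : {σ : Sub {sig} ms γ δ} {θ : Sub {sig} ps γ δ} → msub φ ∘ σ ≗ θ
                     → (x : Terms ms γ n) → msubVec φ (subVec σ x) ≡ subVec θ (msubVec φ x)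
    msubArg-subArg   : {σ : Sub {sig} ms γ δ} {θ : Sub {sig} ps γ δ} → msub φ ∘ σ ≗ θ
                     → (x : Arg {sig} ms γ a) → msubArg φ (subArg σ x) ≡ subArg θ (msubArg φ x)
    msubArgs-subArgs : {σ : Sub {sig} ms γ δ} {θ : Sub {sig} ps γ δ} → msub φ ∘ σ ≗ θ
                     → (x : Args {sig} ms γ as) → msubArgs φ (subArgs σ x) ≡ subArgs θ (msubArgs φ x)
    msub-sub p (var i) = p i
    msub-sub p (sym S es) = cong (sym S) (msubArgs-subArgs p es)
    msub-sub {θ = θ} p (mv M ts) = trans (cong (φ M) (msubVec-subVec p ts)) (commute φ-sub M θ (msubVec φ ts))
    msubVec-subVec p [] = refl
    msubVec-subVec p (t ∷ ts) = cong₂ _∷_ (msub-sub p t) (msubVec-subVec p ts)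
    msubArg-subArg p (expr e) = cong expr (msub-sub p e)
    msubArg-subArg p ⋆ = refl
    msubArg-subArg {σ = σ} p (abs e) = cong abs (msubArg-subArg lifted e)
      where
      lifted : msub φ ∘ liftS σ ≗ liftS _
      lifted zero = refl
      lifted (suc i) = trans (msub-ren suc (σ i)) (cong (ren suc) (p i))
    msubArgs-subArgs p [] = refl
    msubArgs-subArgs p (e ∷ es) = cong₂ _∷_ (msubArg-subArg p e) (msubArgs-subArgs p es)

    msub-▸ : {σ : Sub {sig} ms γ δ} {θ : Sub {sig} ps γ δ} → msub φ ∘ σ ≗ θ
           → (t : Expr {sig} ms δ tm) → msub φ ∘ (t ▸ σ) ≗ (msub φ t ▸ θ)
    msub-▸ p t zero = refl
    msub-▸ p t (suc i) = p i

    msub-apply : {σ : Sub {sig} ms γ δ} {θ : Sub {sig} ps γ δ} → msub φ ∘ σ ≗ θ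
               → (e : Arg {sig} ms γ (obj c , n)) (us : Terms ms δ n)
               → msub φ (apply e σ us) ≡ apply (msubArg φ e) θ (msubVec φ us)
    msub-apply p (expr e) [] = msub-sub p e
    msub-apply p (abs e) (u ∷ us) = msub-apply (msub-▸ p u) e us

    module _ (I : Inst {sig} ms γ sh) where
      msub-inst         : (x : Expr {sig} sh δ c) → msub φ (inst I x) ≡ inst (msubInst φ I) x
      msubVec-instVec   : (x : Terms sh δ n) → msubVec φ (instVec I x) ≡ instVec (msubInst φ I) x
      msubArg-instArg   : (x : Arg {sig} sh δ a) → msubArg φ (instArg I x) ≡ instArg (msubInst φ I) x
      msubArgs-instArgs : (x : Args {sig} sh δ as) → msubArgs φ (instArgs I x) ≡ instArgs (msubInst φ I) x
      msub-inst (var i) = refl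
      msub-inst (sym S es) = cong (sym S) (msubArgs-instArgs es)
      msub-inst (mv M ts) =
        trans (msub-apply (λ _ → refl) (lookupI I M) (instVec I ts))
              (cong₂ (λ u v → apply u _ v) (≡sym (lookupI-msubInst φ I M)) (msubVec-instVec ts))
      msubVec-instVec [] = refl
      msubVec-instVec (t ∷ ts) = cong₂ _∷_ (msub-inst t) (msubVec-instVec ts)
      msubArg-instArg (expr e) = cong expr (msub-inst e)
      msubArg-instArg ⋆ = refl
      msubArg-instArg (abs e) = cong abs (msubArg-instArg e)
      msubArgs-instArgs [] = refl
      msubArgs-instArgs (e ∷ es) = cong₂ _∷_ (msubArg-instArg e) (msubArgs-instArgs es)

  msub-noVars : (φ : MSub ms ps) → msub φ ∘ noVars {sig} {ms} {γ} ≗ noVars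
  msub-noVars φ ()

  instMSub : Inst {sig} ps 0 ms → MSub ms ps
  instMSub I M ts = apply (lookupI I M) noVars ts

  instMSub-commutes : (I : Inst {sig} ps 0 ms) → CommutesWithSub (instMSub I)
  instMSub-commutes I .commute M σ ts = ≡sym (sub-apply (λ ()) (lookupI I M) ts)

  renMSub : MRen {sig} ms ps → MSub ms ps
  renMSub μ M ts = mv (μ M) ts

  renMSub-commutes : (μ : MRen {sig} ms ps) → CommutesWithSub (renMSub μ)
  renMSub-commutes μ .commute M σ ts = refl

  mren≡msub         : (μ : MRen {sig} ms ps) (x : Expr {sig} ms γ c) → mren μ x ≡ msub (renMSub μ) x
  mrenVec≡msubVec   : (μ : MRen {sig} ms ps) (x : Terms ms γ n) → mrenVec μ x ≡ msubVec (renMSub μ) x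
  mrenArg≡msubArg   : (μ : MRen {sig} ms ps) (x : Arg {sig} ms γ a) → mrenArg μ x ≡ msubArg (renMSub μ) x
  mrenArgs≡msubArgs : (μ : MRen {sig} ms ps) (x : Args {sig} ms γ as) → mrenArgs μ x ≡ msubArgs (renMSub μ) x
  mren≡msub μ (var i) = refl
  mren≡msub μ (sym S es) = cong (sym S) (mrenArgs≡msubArgs μ es)
  mren≡msub μ (mv M ts) = cong (mv (μ M)) (mrenVec≡msubVec μ ts)
  mrenVec≡msubVec μ [] = refl
  mrenVec≡msubVec μ (t ∷ ts) = cong₂ _∷_ (mren≡msub μ t) (mrenVec≡msubVec μ ts)
  mrenArg≡msubArg μ (expr e) = cong expr (mren≡msub μ e)
  mrenArg≡msubArg μ ⋆ = refl
  mrenArg≡msubArg μ (abs e) = cong abs (mrenArg≡msubArg μ e)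
  mrenArgs≡msubArgs μ [] = refl
  mrenArgs≡msubArgs μ (e ∷ es) = cong₂ _∷_ (mrenArg≡msubArg μ e) (mrenArgs≡msubArgs μ es)

  wkInst≡msubInst : (I : Inst {sig} ps γ sh) → wkInst {b = a} I ≡ msubInst (renMSub there) I
  wkInst≡msubInst [] = refl
  wkInst≡msubInst (e ∷ I) = cong₂ _∷_ (mrenArg≡msubArg there e) (wkInst≡msubInst I)

  msub-renMSub         : (φ : MSub ps ns) (μ : MRen {sig} ms ps) (x : Expr {sig} ms γ c)
                       → msub φ (msub (renMSub μ) x) ≡ msub (φ ∘ μ) x
  msubVec-renMSub      : (φ : MSub ps ns) (μ : MRen {sig} ms ps) (x : Terms ms γ n)
                       → msubVec φ (msubVec (renMSub μ) x) ≡ msubVec (φ ∘ μ) x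
  msubArg-renMSub      : (φ : MSub ps ns) (μ : MRen {sig} ms ps) (x : Arg {sig} ms γ a)
                       → msubArg φ (msubArg (renMSub μ) x) ≡ msubArg (φ ∘ μ) x
  msubArgs-renMSub     : (φ : MSub ps ns) (μ : MRen {sig} ms ps) (x : Args {sig} ms γ as)
                       → msubArgs φ (msubArgs (renMSub μ) x) ≡ msubArgs (φ ∘ μ) x
  msub-renMSub φ μ (var i) = refl
  msub-renMSub φ μ (sym S es) = cong (sym S) (msubArgs-renMSub φ μ es)
  msub-renMSub φ μ (mv M ts) = cong (φ (μ M)) (msubVec-renMSub φ μ ts)
  msubVec-renMSub φ μ [] = refl
  msubVec-renMSub φ μ (t ∷ ts) = cong₂ _∷_ (msub-renMSub φ μ t) (msubVec-renMSub φ μ ts)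
  msubArg-renMSub φ μ (expr e) = cong expr (msub-renMSub φ μ e)
  msubArg-renMSub φ μ ⋆ = refl
  msubArg-renMSub φ μ (abs e) = cong abs (msubArg-renMSub φ μ e)
  msubArgs-renMSub φ μ [] = refl
  msubArgs-renMSub φ μ (e ∷ es) = cong₂ _∷_ (msubArg-renMSub φ μ e) (msubArgs-renMSub φ μ es)

  -- Over the empty variable context, instantiating is the metavariable substitution instMSub,
  -- up to the renaming ρ that identifies γ + 0 with γ.
  module _ (I : Inst {sig} ps 0 ms) where
    inst≡msub         : {ρ : Ren {sig} γ (γ + 0)} → (∀ i → ρ i ≡ i ↑ˡ 0)
                      → (x : Expr {sig} ms γ c) → inst I x ≡ ren ρ (msub (instMSub I) x)
    instVec≡msubVec   : {ρ : Ren {sig} γ (γ + 0)} → (∀ i → ρ i ≡ i ↑ˡ 0)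
                      → (x : Terms ms γ n) → instVec I x ≡ renVec ρ (msubVec (instMSub I) x)
    instArg≡msubArg   : {ρ : Ren {sig} γ (γ + 0)} → (∀ i → ρ i ≡ i ↑ˡ 0)
                      → (x : Arg {sig} ms γ a) → instArg I x ≡ renArg ρ (msubArg (instMSub I) x)
    instArgs≡msubArgs : {ρ : Ren {sig} γ (γ + 0)} → (∀ i → ρ i ≡ i ↑ˡ 0)
                      → (x : Args {sig} ms γ as) → instArgs I x ≡ renArgs ρ (msubArgs (instMSub I) x)
    inst≡msub ρ-id (var i) = cong var (≡sym (ρ-id i))
    inst≡msub ρ-id (sym S es) = cong (sym S) (instArgs≡msubArgs ρ-id es)
    inst≡msub {ρ = ρ} ρ-id (mv M ts) = begin
      apply (lookupI I M) _ (instVec I ts)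
        ≡⟨ cong (apply (lookupI I M) _) (instVec≡msubVec ρ-id ts) ⟩
      apply (lookupI I M) _ (renVec ρ (msubVec (instMSub I) ts))
        ≡⟨ cong (apply (lookupI I M) _) (renVec≡subVec ρ _) ⟩
      apply (lookupI I M) _ (subVec (varSub ρ) (msubVec (instMSub I) ts))
        ≡⟨ apply-cong (λ ()) (lookupI I M) _ ⟩
      apply (lookupI I M) (sub (varSub ρ) ∘ noVars) (subVec (varSub ρ) (msubVec (instMSub I) ts))
        ≡⟨ sub-apply (λ ()) (lookupI I M) (msubVec (instMSub I) ts) ⟨
      sub (varSub ρ) (instMSub I M (msubVec (instMSub I) ts))
        ≡⟨ ren≡sub ρ _ ⟨
      ren ρ (instMSub I M (msubVec (instMSub I) ts)) ∎
    instVec≡msubVec ρ-id [] = refl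
    instVec≡msubVec ρ-id (t ∷ ts) = cong₂ _∷_ (inst≡msub ρ-id t) (instVec≡msubVec ρ-id ts)
    instArg≡msubArg ρ-id (expr e) = cong expr (inst≡msub ρ-id e)
    instArg≡msubArg ρ-id ⋆ = refl
    instArg≡msubArg ρ-id (abs e) = cong abs (instArg≡msubArg (λ { zero → refl ; (suc i) → cong suc (ρ-id i) }) e)
    instArgs≡msubArgs ρ-id [] = refl
    instArgs≡msubArgs ρ-id (e ∷ es) = cong₂ _∷_ (instArg≡msubArg ρ-id e) (instArgs≡msubArgs ρ-id es)

  msub-genInst     : (x : Expr {sig} ms γ c) → msub (instMSub (genInst ms)) x ≡ x
  msubVec-genInst  : (x : Terms ms γ n) → msubVec (instMSub (genInst ms)) x ≡ x
  msubArg-genInst  : (x : Arg {sig} ms γ a) → msubArg (instMSub (genInst ms)) x ≡ x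
  msubArgs-genInst : (x : Args {sig} ms γ as) → msubArgs (instMSub (genInst ms)) x ≡ x
  msub-genInst (var i) = refl
  msub-genInst (sym S es) = cong (sym S) (msubArgs-genInst es)
  msub-genInst {ms = ms} (mv M ts) = begin
    apply (lookupI (genInst ms) M) noVars (msubVec (instMSub (genInst ms)) ts)
      ≡⟨ cong (λ u → apply u noVars _) (lookupI-genInst ms M) ⟩
    apply (hat M) noVars (msubVec (instMSub (genInst ms)) ts)
      ≡⟨ cong (apply (hat M) noVars) (msubVec-genInst ts) ⟩
    apply (hat M) noVars ts
      ≡⟨ apply-hat M noVars ts ⟩
    mv M ts ∎
  msubVec-genInst [] = refl
  msubVec-genInst (t ∷ ts) = cong₂ _∷_ (msub-genInst t) (msubVec-genInst ts)
  msubArg-genInst (expr e) = cong expr (msub-genInst e)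
  msubArg-genInst ⋆ = refl
  msubArg-genInst (abs e) = cong abs (msubArg-genInst e)
  msubArgs-genInst [] = refl
  msubArgs-genInst (e ∷ es) = cong₂ _∷_ (msubArg-genInst e) (msubArgs-genInst es)

  subBBdry : Sub {sig} ms γ δ → BBdry {sig} ms γ a → BBdry {sig} ms δ a
  subBBdry σ (bdry b) = bdry (subBdry σ b)
  subBBdry σ (babs A bb) = babs (sub σ A) (subBBdry (liftS σ) bb)

  subJudg : Sub {sig} ms γ δ → Judg {sig} ms γ cl → Judg {sig} ms δ cl
  subJudg σ (isType A) = isType (sub σ A)
  subJudg σ (hasType t A) = hasType (sub σ t) (sub σ A)
  subJudg σ (eqType A B) = eqType (sub σ A) (sub σ B)
  subJudg σ (eqTerm s t A) = eqTerm (sub σ s) (sub σ t) (sub σ A)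

  subJJudg : Sub {sig} ms γ δ → JJudg {sig} ms γ a → JJudg {sig} ms δ a
  subJJudg σ (judg j) = judg (subJudg σ j)
  subJJudg σ (jabs A j) = jabs (sub σ A) (subJJudg (liftS σ) j)

  subGoal : Sub {sig} ms γ δ → Goal {sig} ms γ → Goal {sig} ms δ
  subGoal σ (jdg j) = jdg (subJJudg σ j)
  subGoal σ (bdy b) = bdy (subBBdry σ b)

  msubBdry : MSub ms ps → Bdry {sig} ms γ cl → Bdry {sig} ps γ cl
  msubBdry φ □type = □type
  msubBdry φ (□∶ A) = □∶ msub φ A
  msubBdry φ (A ≡ B by□) = msub φ A ≡ msub φ B by□
  msubBdry φ (s ≡ t ∶ A by□) = msub φ s ≡ msub φ t ∶ msub φ A by□

  msubBBdry : MSub ms ps → BBdry {sig} ms γ a → BBdry {sig} ps γ a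
  msubBBdry φ (bdry b) = bdry (msubBdry φ b)
  msubBBdry φ (babs A bb) = babs (msub φ A) (msubBBdry φ bb)

  msubJudg : MSub ms ps → Judg {sig} ms γ cl → Judg {sig} ps γ cl
  msubJudg φ (isType A) = isType (msub φ A)
  msubJudg φ (hasType t A) = hasType (msub φ t) (msub φ A)
  msubJudg φ (eqType A B) = eqType (msub φ A) (msub φ B)
  msubJudg φ (eqTerm s t A) = eqTerm (msub φ s) (msub φ t) (msub φ A)

  msubJJudg : MSub ms ps → JJudg {sig} ms γ a → JJudg {sig} ps γ a
  msubJJudg φ (judg j) = judg (msubJudg φ j)
  msubJJudg φ (jabs A j) = jabs (msub φ A) (msubJJudg φ j)

  msubGoal : MSub ms ps → Goal {sig} ms γ → Goal {sig} ps γ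
  msubGoal φ (jdg j) = jdg (msubJJudg φ j)
  msubGoal φ (bdy b) = bdy (msubBBdry φ b)

  msubCtx : MSub ms ps → VCtx {sig} ms γ → VCtx {sig} ps γ
  msubCtx φ ∅ = ∅
  msubCtx φ (Γ ▷ A) = msubCtx φ Γ ▷ msub φ A

  subBdry-cong : {σ σ′ : Sub {sig} ms γ δ} → σ ≗ σ′ → (b : Bdry {sig} ms γ cl) → subBdry σ b ≡ subBdry σ′ b
  subBdry-cong p □type = refl
  subBdry-cong p (□∶ A) = cong □∶_ (sub-cong p A)
  subBdry-cong p (A ≡ B by□) = cong₂ _≡_by□ (sub-cong p A) (sub-cong p B)
  subBdry-cong p (s ≡ t ∶ A by□) = cong₃ _≡_∶_by□ (sub-cong p s) (sub-cong p t) (sub-cong p A)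

  subBdry-id : {σ : Sub {sig} ms γ γ} → σ ≗ var → (b : Bdry {sig} ms γ cl) → subBdry σ b ≡ b
  subBdry-id p □type = refl
  subBdry-id p (□∶ A) = cong □∶_ (sub-id p A)
  subBdry-id p (A ≡ B by□) = cong₂ _≡_by□ (sub-id p A) (sub-id p B)
  subBdry-id p (s ≡ t ∶ A by□) = cong₃ _≡_∶_by□ (sub-id p s) (sub-id p t) (sub-id p A)

  subBdry-subBdry : {τ : Sub {sig} ms δ ε} {σ : Sub {sig} ms γ δ} {θ : Sub {sig} ms γ ε} → sub τ ∘ σ ≗ θ
                  → (b : Bdry {sig} ms γ cl) → subBdry τ (subBdry σ b) ≡ subBdry θ b
  subBdry-subBdry p □type = refl
  subBdry-subBdry p (□∶ A) = cong □∶_ (sub-sub p A)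
  subBdry-subBdry p (A ≡ B by□) = cong₂ _≡_by□ (sub-sub p A) (sub-sub p B)
  subBdry-subBdry p (s ≡ t ∶ A by□) = cong₃ _≡_∶_by□ (sub-sub p s) (sub-sub p t) (sub-sub p A)

  metaArgGoals-cong : {σ σ′ : Sub {sig} ms γ δ} → σ ≗ σ′ → (bb : BBdry {sig} ms γ (cl , n)) (ts : Terms ms δ n)
                    → metaArgGoals bb σ ts ≡ metaArgGoals bb σ′ ts
  metaArgGoals-cong p (bdry b) [] = refl
  metaArgGoals-cong p (babs A bb) (t ∷ ts) =
    cong₂ _∷_ (cong (J₀ ∘ hasType t) (sub-cong p A)) (metaArgGoals-cong (▸-cong p t) bb ts)

  metaBdry-cong : {σ σ′ : Sub {sig} ms γ δ} → σ ≗ σ′ → (bb : BBdry {sig} ms γ (cl , n)) (ts : Terms ms δ n)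
                → metaBdry bb σ ts ≡ metaBdry bb σ′ ts
  metaBdry-cong p (bdry b) [] = subBdry-cong p b
  metaBdry-cong p (babs A bb) (t ∷ ts) = metaBdry-cong (▸-cong p t) bb ts

  sub-metaArgGoals : {τ : Sub {sig} ms δ ε} {σ : Sub {sig} ms γ δ} {θ : Sub {sig} ms γ ε} → sub τ ∘ σ ≗ θ
                   → (bb : BBdry {sig} ms γ (cl , n)) (ts : Terms ms δ n)
                   → map (subGoal τ) (metaArgGoals bb σ ts) ≡ metaArgGoals bb θ (subVec τ ts)
  sub-metaArgGoals p (bdry b) [] = refl
  sub-metaArgGoals p (babs A bb) (t ∷ ts) =
    cong₂ _∷_ (cong (J₀ ∘ hasType _) (sub-sub p A)) (sub-metaArgGoals (sub-▸ p t) bb ts)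

  subBdry-metaBdry : {τ : Sub {sig} ms δ ε} {σ : Sub {sig} ms γ δ} {θ : Sub {sig} ms γ ε} → sub τ ∘ σ ≗ θ
                   → (bb : BBdry {sig} ms γ (cl , n)) (ts : Terms ms δ n)
                   → subBdry τ (metaBdry bb σ ts) ≡ metaBdry bb θ (subVec τ ts)
  subBdry-metaBdry p (bdry b) [] = subBdry-subBdry p b
  subBdry-metaBdry p (babs A bb) (t ∷ ts) = subBdry-metaBdry (sub-▸ p t) bb ts

  sub-eqArgGoals : {τ : Sub {sig} ms δ ε} {σ : Sub {sig} ms γ δ} {θ : Sub {sig} ms γ ε} → sub τ ∘ σ ≗ θ
                 → (bb : BBdry {sig} ms γ (cl , n)) (ss ts : Terms ms δ n)
                 → map (subGoal τ) (eqArgGoals bb σ ss ts) ≡ eqArgGoals bb θ (subVec τ ss) (subVec τ ts)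
  sub-eqArgGoals p (bdry b) [] [] = refl
  sub-eqArgGoals p (babs A bb) (s ∷ ss) (t ∷ ts) =
    cong₂ _∷_ (cong (J₀ ∘ eqTerm _ _) (sub-sub p A)) (sub-eqArgGoals (sub-▸ p s) bb ss ts)

  sub-bdryEqGoals : (σ : Sub {sig} ms γ δ) (b b′ : Bdry {sig} ms γ (obj c))
                  → map (subGoal σ) (bdryEqGoals b b′) ≡ bdryEqGoals (subBdry σ b) (subBdry σ b′)
  sub-bdryEqGoals σ □type □type = refl
  sub-bdryEqGoals σ (□∶ C) (□∶ C′) = refl

  subJudg-fill₀ : (σ : Sub {sig} ms γ δ) (b : Bdry {sig} ms γ cl) (e : Arg {sig} ms γ (cl , 0))
                → subJudg σ (fill₀ b e) ≡ fill₀ (subBdry σ b) (subArg σ e)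
  subJudg-fill₀ σ □type (expr x) = refl
  subJudg-fill₀ σ (□∶ A) (expr x) = refl
  subJudg-fill₀ σ (A ≡ B by□) ⋆ = refl
  subJudg-fill₀ σ (s ≡ t ∶ A by□) ⋆ = refl

  subJJudg-fill : (σ : Sub {sig} ms γ δ) (bb : BBdry {sig} ms γ a) (e : Arg {sig} ms γ a)
                → subJJudg σ (fill bb e) ≡ fill (subBBdry σ bb) (subArg σ e)
  subJJudg-fill σ (bdry b) e = cong judg (subJudg-fill₀ σ b e)
  subJJudg-fill σ (babs A bb) (abs e) = cong (jabs _) (subJJudg-fill (liftS σ) bb e)

  subJudg-fillEq₀ : (σ : Sub {sig} ms γ δ) (b : Bdry {sig} ms γ (obj c)) (x y : Expr {sig} ms γ c)
                  → subJudg σ (fillEq₀ b x y) ≡ fillEq₀ (subBdry σ b) (sub σ x) (sub σ y)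
  subJudg-fillEq₀ σ □type x y = refl
  subJudg-fillEq₀ σ (□∶ A) x y = refl

  subJJudg-fillEq : (σ : Sub {sig} ms γ δ) (bb : BBdry {sig} ms γ (obj c , n)) (e f : Arg {sig} ms γ (obj c , n))
                  → subJJudg σ (fillEq bb e f) ≡ fillEq (subBBdry σ bb) (subArg σ e) (subArg σ f)
  subJJudg-fillEq σ (bdry b) (expr x) (expr y) = cong judg (subJudg-fillEq₀ σ b x y)
  subJJudg-fillEq σ (babs A bb) (abs e) (abs f) = cong (jabs _) (subJJudg-fillEq (liftS σ) bb e f)

  module _ (σ : Sub {sig} ms γ δ) (I : Inst {sig} ms γ sh) where
    subBdry-instBdry : {d : ℕ} {τ : Sub {sig} ms (d + γ) (d + δ)} → IsLift σ I d τ
                     → (b : Bdry {sig} sh d cl) → subBdry τ (instBdry I b) ≡ instBdry (subInst σ I) b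
    subBdry-instBdry lift □type = refl
    subBdry-instBdry lift (□∶ A) = cong □∶_ (sub-inst σ I lift A)
    subBdry-instBdry lift (A ≡ B by□) = cong₂ _≡_by□ (sub-inst σ I lift A) (sub-inst σ I lift B)
    subBdry-instBdry lift (s ≡ t ∶ A by□) =
      cong₃ _≡_∶_by□ (sub-inst σ I lift s) (sub-inst σ I lift t) (sub-inst σ I lift A)

    subBBdry-instBB : {d : ℕ} {τ : Sub {sig} ms (d + γ) (d + δ)} → IsLift σ I d τ
                    → (bb : BBdry {sig} sh d a) → subBBdry τ (instBB I bb) ≡ instBB (subInst σ I) bb
    subBBdry-instBB lift (bdry b) = cong bdry (subBdry-instBdry lift b)
    subBBdry-instBB lift (babs A bb) = cong₂ babs (sub-inst σ I lift A) (subBBdry-instBB (IsLift-suc σ I lift) bb)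

    subBdry-instBdry₀ : (b : Bdry {sig} sh 0 cl) → subBdry σ (instBdry I b) ≡ instBdry (subInst σ I) b
    subBdry-instBdry₀ = subBdry-instBdry (IsLift-zero σ I)

    subJudg-instJudg : (j : Judg {sig} sh 0 cl) → subJudg σ (instJudg I j) ≡ instJudg (subInst σ I) j
    subJudg-instJudg (isType A) = cong isType (sub-inst₀ σ I A)
    subJudg-instJudg (hasType t A) = cong₂ hasType (sub-inst₀ σ I t) (sub-inst₀ σ I A)
    subJudg-instJudg (eqType A B) = cong₂ eqType (sub-inst₀ σ I A) (sub-inst₀ σ I B)
    subJudg-instJudg (eqTerm s t A) = cong₃ eqTerm (sub-inst₀ σ I s) (sub-inst₀ σ I t) (sub-inst₀ σ I A)

  sub-instPrems : (σ : Sub {sig} ms γ δ) (Ξ : MCtx {sig} sh) (I : Inst {sig} ms γ sh)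
                → map (subGoal σ) (instPrems Ξ I) ≡ instPrems Ξ (subInst σ I)
  sub-instPrems σ ∅ [] = refl
  sub-instPrems σ (Ξ ▷ bb) (e ∷ I) = cong₂ _∷_
    (cong jdg (trans (subJJudg-fill σ (instBB I bb) e)
                     (cong (λ X → fill X _) (subBBdry-instBB σ I (IsLift-zero σ I) bb))))
    (sub-instPrems σ Ξ I)

  sub-congPrems : (σ : Sub {sig} ms γ δ) (Ξ : MCtx {sig} sh) (I J : Inst {sig} ms γ sh)
                → map (subGoal σ) (congPrems Ξ I J) ≡ congPrems Ξ (subInst σ I) (subInst σ J)
  sub-congPrems σ ∅ [] [] = refl
  sub-congPrems σ (_▷_ {a = obj c , n} Ξ bb) (e ∷ I) (f ∷ J) = cong₂ _∷_
    (cong jdg (trans (subJJudg-fillEq σ (instBB I bb) e f)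
                     (cong (λ X → fillEq X _ _) (subBBdry-instBB σ I (IsLift-zero σ I) bb))))
    (sub-congPrems σ Ξ I J)
  sub-congPrems σ (_▷_ {a = eq c , n} Ξ bb) (e ∷ I) (f ∷ J) = sub-congPrems σ Ξ I J

  sub-congExtra : (σ : Sub {sig} ms γ δ) (j : Judg {sig} sh 0 cl) (I J : Inst {sig} ms γ sh)
                → map (subGoal σ) (congExtra j I J) ≡ congExtra j (subInst σ I) (subInst σ J)
  sub-congExtra σ (isType A) I J = refl
  sub-congExtra σ (hasType t A) I J =
    cong (λ A≡A′ → J₀ A≡A′ ∷ []) (cong₂ eqType (sub-inst₀ σ I A) (sub-inst₀ σ J A))
  sub-congExtra σ (eqType A B) I J = refl
  sub-congExtra σ (eqTerm s t A) I J = refl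

  subJudg-congConcl : (σ : Sub {sig} ms γ δ) (j : Judg {sig} sh 0 cl) (o : IsObj {sig} cl) (I J : Inst {sig} ms γ sh)
                    → subJudg σ (congConcl j o I J) ≡ congConcl j o (subInst σ I) (subInst σ J)
  subJudg-congConcl σ (isType A) o I J = cong₂ eqType (sub-inst₀ σ I A) (sub-inst₀ σ J A)
  subJudg-congConcl σ (hasType t A) o I J = cong₃ eqTerm (sub-inst₀ σ I t) (sub-inst₀ σ J t) (sub-inst₀ σ I A)

  msub-bdryEqGoals : (φ : MSub ms ps) (b b′ : Bdry {sig} ms γ (obj c))
                   → map (msubGoal φ) (bdryEqGoals b b′) ≡ bdryEqGoals (msubBdry φ b) (msubBdry φ b′)
  msub-bdryEqGoals φ □type □type = refl
  msub-bdryEqGoals φ (□∶ C) (□∶ C′) = refl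

  msubJudg-fill₀ : (φ : MSub ms ps) (b : Bdry {sig} ms γ cl) (e : Arg {sig} ms γ (cl , 0))
                 → msubJudg φ (fill₀ b e) ≡ fill₀ (msubBdry φ b) (msubArg φ e)
  msubJudg-fill₀ φ □type (expr x) = refl
  msubJudg-fill₀ φ (□∶ A) (expr x) = refl
  msubJudg-fill₀ φ (A ≡ B by□) ⋆ = refl
  msubJudg-fill₀ φ (s ≡ t ∶ A by□) ⋆ = refl

  msubJJudg-fill : (φ : MSub ms ps) (bb : BBdry {sig} ms γ a) (e : Arg {sig} ms γ a)
                 → msubJJudg φ (fill bb e) ≡ fill (msubBBdry φ bb) (msubArg φ e)
  msubJJudg-fill φ (bdry b) e = cong judg (msubJudg-fill₀ φ b e)
  msubJJudg-fill φ (babs A bb) (abs e) = cong (jabs _) (msubJJudg-fill φ bb e)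

  msubJudg-fillEq₀ : (φ : MSub ms ps) (b : Bdry {sig} ms γ (obj c)) (x y : Expr {sig} ms γ c)
                   → msubJudg φ (fillEq₀ b x y) ≡ fillEq₀ (msubBdry φ b) (msub φ x) (msub φ y)
  msubJudg-fillEq₀ φ □type x y = refl
  msubJudg-fillEq₀ φ (□∶ A) x y = refl

  msubJJudg-fillEq : (φ : MSub ms ps) (bb : BBdry {sig} ms γ (obj c , n)) (e f : Arg {sig} ms γ (obj c , n))
                   → msubJJudg φ (fillEq bb e f) ≡ fillEq (msubBBdry φ bb) (msubArg φ e) (msubArg φ f)
  msubJJudg-fillEq φ (bdry b) (expr x) (expr y) = cong judg (msubJudg-fillEq₀ φ b x y)
  msubJJudg-fillEq φ (babs A bb) (abs e) (abs f) = cong (jabs _) (msubJJudg-fillEq φ bb e f)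

  module _ {φ : MSub ms ps} (φ-sub : CommutesWithSub φ) where
    lookupTy-msubCtx : (Γ : VCtx {sig} ms γ) (i : Fin γ) → lookupTy (msubCtx φ Γ) i ≡ msub φ (lookupTy Γ i)
    lookupTy-msubCtx (Γ ▷ A) zero = ≡sym (msub-ren φ-sub suc A)
    lookupTy-msubCtx (Γ ▷ A) (suc i) =
      trans (cong (ren suc) (lookupTy-msubCtx Γ i)) (≡sym (msub-ren φ-sub suc (lookupTy Γ i)))

    msubBdry-subBdry : {σ : Sub {sig} ms γ δ} {θ : Sub {sig} ps γ δ} → msub φ ∘ σ ≗ θ
                     → (b : Bdry {sig} ms γ cl) → msubBdry φ (subBdry σ b) ≡ subBdry θ (msubBdry φ b)
    msubBdry-subBdry p □type = refl
    msubBdry-subBdry p (□∶ A) = cong □∶_ (msub-sub φ-sub p A)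
    msubBdry-subBdry p (A ≡ B by□) = cong₂ _≡_by□ (msub-sub φ-sub p A) (msub-sub φ-sub p B)
    msubBdry-subBdry p (s ≡ t ∶ A by□) =
      cong₃ _≡_∶_by□ (msub-sub φ-sub p s) (msub-sub φ-sub p t) (msub-sub φ-sub p A)

    msub-metaArgGoals : {σ : Sub {sig} ms γ δ} {θ : Sub {sig} ps γ δ} → msub φ ∘ σ ≗ θ
                      → (bb : BBdry {sig} ms γ (cl , n)) (ts : Terms ms δ n)
                      → map (msubGoal φ) (metaArgGoals bb σ ts) ≡ metaArgGoals (msubBBdry φ bb) θ (msubVec φ ts)
    msub-metaArgGoals p (bdry b) [] = refl
    msub-metaArgGoals p (babs A bb) (t ∷ ts) =
      cong₂ _∷_ (cong (J₀ ∘ hasType _) (msub-sub φ-sub p A)) (msub-metaArgGoals (msub-▸ φ-sub p t) bb ts)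

    msubBdry-metaBdry : {σ : Sub {sig} ms γ δ} {θ : Sub {sig} ps γ δ} → msub φ ∘ σ ≗ θ
                      → (bb : BBdry {sig} ms γ (cl , n)) (ts : Terms ms δ n)
                      → msubBdry φ (metaBdry bb σ ts) ≡ metaBdry (msubBBdry φ bb) θ (msubVec φ ts)
    msubBdry-metaBdry p (bdry b) [] = msubBdry-subBdry p b
    msubBdry-metaBdry p (babs A bb) (t ∷ ts) = msubBdry-metaBdry (msub-▸ φ-sub p t) bb ts

    msub-eqArgGoals : {σ : Sub {sig} ms γ δ} {θ : Sub {sig} ps γ δ} → msub φ ∘ σ ≗ θ
                    → (bb : BBdry {sig} ms γ (cl , n)) (ss ts : Terms ms δ n)
                    → map (msubGoal φ) (eqArgGoals bb σ ss ts)
                    ≡ eqArgGoals (msubBBdry φ bb) θ (msubVec φ ss) (msubVec φ ts)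
    msub-eqArgGoals p (bdry b) [] [] = refl
    msub-eqArgGoals p (babs A bb) (s ∷ ss) (t ∷ ts) =
      cong₂ _∷_ (cong (J₀ ∘ eqTerm _ _) (msub-sub φ-sub p A)) (msub-eqArgGoals (msub-▸ φ-sub p s) bb ss ts)

    module _ (I : Inst {sig} ms γ sh) where
      msubBdry-instBdry : (b : Bdry {sig} sh δ cl) → msubBdry φ (instBdry I b) ≡ instBdry (msubInst φ I) b
      msubBdry-instBdry □type = refl
      msubBdry-instBdry (□∶ A) = cong □∶_ (msub-inst φ-sub I A)
      msubBdry-instBdry (A ≡ B by□) = cong₂ _≡_by□ (msub-inst φ-sub I A) (msub-inst φ-sub I B)
      msubBdry-instBdry (s ≡ t ∶ A by□) =
        cong₃ _≡_∶_by□ (msub-inst φ-sub I s) (msub-inst φ-sub I t) (msub-inst φ-sub I A)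

      msubBBdry-instBB : (bb : BBdry {sig} sh δ a) → msubBBdry φ (instBB I bb) ≡ instBB (msubInst φ I) bb
      msubBBdry-instBB (bdry b) = cong bdry (msubBdry-instBdry b)
      msubBBdry-instBB (babs A bb) = cong₂ babs (msub-inst φ-sub I A) (msubBBdry-instBB bb)

      msubJudg-instJudg : (j : Judg {sig} sh 0 cl) → msubJudg φ (instJudg I j) ≡ instJudg (msubInst φ I) j
      msubJudg-instJudg (isType A) = cong isType (msub-inst φ-sub I A)
      msubJudg-instJudg (hasType t A) = cong₂ hasType (msub-inst φ-sub I t) (msub-inst φ-sub I A)
      msubJudg-instJudg (eqType A B) = cong₂ eqType (msub-inst φ-sub I A) (msub-inst φ-sub I B)
      msubJudg-instJudg (eqTerm s t A) =
        cong₃ eqTerm (msub-inst φ-sub I s) (msub-inst φ-sub I t) (msub-inst φ-sub I A)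

    msub-instPrems : (Ξ : MCtx {sig} sh) (I : Inst {sig} ms γ sh)
                   → map (msubGoal φ) (instPrems Ξ I) ≡ instPrems Ξ (msubInst φ I)
    msub-instPrems ∅ [] = refl
    msub-instPrems (Ξ ▷ bb) (e ∷ I) = cong₂ _∷_
      (cong jdg (trans (msubJJudg-fill φ (instBB I bb) e) (cong (λ X → fill X _) (msubBBdry-instBB I bb))))
      (msub-instPrems Ξ I)

    msub-congPrems : (Ξ : MCtx {sig} sh) (I J : Inst {sig} ms γ sh)
                   → map (msubGoal φ) (congPrems Ξ I J) ≡ congPrems Ξ (msubInst φ I) (msubInst φ J)
    msub-congPrems ∅ [] [] = refl
    msub-congPrems (_▷_ {a = obj c , n} Ξ bb) (e ∷ I) (f ∷ J) = cong₂ _∷_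
      (cong jdg (trans (msubJJudg-fillEq φ (instBB I bb) e f) (cong (λ X → fillEq X _ _) (msubBBdry-instBB I bb))))
      (msub-congPrems Ξ I J)
    msub-congPrems (_▷_ {a = eq c , n} Ξ bb) (e ∷ I) (f ∷ J) = msub-congPrems Ξ I J

    msub-congExtra : (j : Judg {sig} sh 0 cl) (I J : Inst {sig} ms γ sh)
                   → map (msubGoal φ) (congExtra j I J) ≡ congExtra j (msubInst φ I) (msubInst φ J)
    msub-congExtra (isType A) I J = refl
    msub-congExtra (hasType t A) I J =
      cong (λ A≡A′ → J₀ A≡A′ ∷ []) (cong₂ eqType (msub-inst φ-sub I A) (msub-inst φ-sub J A))
    msub-congExtra (eqType A B) I J = refl
    msub-congExtra (eqTerm s t A) I J = refl

    msubJudg-congConcl : (j : Judg {sig} sh 0 cl) (o : IsObj {sig} cl) (I J : Inst {sig} ms γ sh)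
                       → msubJudg φ (congConcl j o I J) ≡ congConcl j o (msubInst φ I) (msubInst φ J)
    msubJudg-congConcl (isType A) o I J = cong₂ eqType (msub-inst φ-sub I A) (msub-inst φ-sub J A)
    msubJudg-congConcl (hasType t A) o I J =
      cong₃ eqTerm (msub-inst φ-sub I t) (msub-inst φ-sub J t) (msub-inst φ-sub I A)

  mrenBdry≡msubBdry : (μ : MRen {sig} ms ps) (b : Bdry {sig} ms γ cl) → mrenBdry μ b ≡ msubBdry (renMSub μ) b
  mrenBdry≡msubBdry μ □type = refl
  mrenBdry≡msubBdry μ (□∶ A) = cong □∶_ (mren≡msub μ A)
  mrenBdry≡msubBdry μ (A ≡ B by□) = cong₂ _≡_by□ (mren≡msub μ A) (mren≡msub μ B)
  mrenBdry≡msubBdry μ (s ≡ t ∶ A by□) = cong₃ _≡_∶_by□ (mren≡msub μ s) (mren≡msub μ t) (mren≡msub μ A)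

  mrenBB≡msubBBdry : (μ : MRen {sig} ms ps) (bb : BBdry {sig} ms γ a) → mrenBB μ bb ≡ msubBBdry (renMSub μ) bb
  mrenBB≡msubBBdry μ (bdry b) = cong bdry (mrenBdry≡msubBdry μ b)
  mrenBB≡msubBBdry μ (babs A bb) = cong₂ babs (mren≡msub μ A) (mrenBB≡msubBBdry μ bb)

  msubBdry-renMSub : (φ : MSub ps ns) (μ : MRen {sig} ms ps) (b : Bdry {sig} ms γ cl)
                   → msubBdry φ (msubBdry (renMSub μ) b) ≡ msubBdry (φ ∘ μ) b
  msubBdry-renMSub φ μ □type = refl
  msubBdry-renMSub φ μ (□∶ A) = cong □∶_ (msub-renMSub φ μ A)
  msubBdry-renMSub φ μ (A ≡ B by□) = cong₂ _≡_by□ (msub-renMSub φ μ A) (msub-renMSub φ μ B)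
  msubBdry-renMSub φ μ (s ≡ t ∶ A by□) =
    cong₃ _≡_∶_by□ (msub-renMSub φ μ s) (msub-renMSub φ μ t) (msub-renMSub φ μ A)

  msubBBdry-renMSub : (φ : MSub ps ns) (μ : MRen {sig} ms ps) (bb : BBdry {sig} ms γ a)
                    → msubBBdry φ (msubBBdry (renMSub μ) bb) ≡ msubBBdry (φ ∘ μ) bb
  msubBBdry-renMSub φ μ (bdry b) = cong bdry (msubBdry-renMSub φ μ b)
  msubBBdry-renMSub φ μ (babs A bb) = cong₂ babs (msub-renMSub φ μ A) (msubBBdry-renMSub φ μ bb)

  msubBdry-genInst : (b : Bdry {sig} ms γ cl) → msubBdry (instMSub (genInst ms)) b ≡ b
  msubBdry-genInst □type = refl
  msubBdry-genInst (□∶ A) = cong □∶_ (msub-genInst A)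
  msubBdry-genInst (A ≡ B by□) = cong₂ _≡_by□ (msub-genInst A) (msub-genInst B)
  msubBdry-genInst (s ≡ t ∶ A by□) = cong₃ _≡_∶_by□ (msub-genInst s) (msub-genInst t) (msub-genInst A)

  msubBBdry-genInst : (bb : BBdry {sig} ms γ a) → msubBBdry (instMSub (genInst ms)) bb ≡ bb
  msubBBdry-genInst (bdry b) = cong bdry (msubBdry-genInst b)
  msubBBdry-genInst (babs A bb) = cong₂ babs (msub-genInst A) (msubBBdry-genInst bb)

  renBdry : Ren {sig} γ δ → Bdry {sig} ms γ cl → Bdry {sig} ms δ cl
  renBdry ρ □type = □type
  renBdry ρ (□∶ A) = □∶ ren ρ A
  renBdry ρ (A ≡ B by□) = ren ρ A ≡ ren ρ B by□
  renBdry ρ (s ≡ t ∶ A by□) = ren ρ s ≡ ren ρ t ∶ ren ρ A by□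

  renBBdry : Ren {sig} γ δ → BBdry {sig} ms γ a → BBdry {sig} ms δ a
  renBBdry ρ (bdry b) = bdry (renBdry ρ b)
  renBBdry ρ (babs A bb) = babs (ren ρ A) (renBBdry (liftR {sig} ρ) bb)

  renBdry-id : {ρ : Ren {sig} γ γ} → ρ ≗ id → (b : Bdry {sig} ms γ cl) → renBdry ρ b ≡ b
  renBdry-id p □type = refl
  renBdry-id p (□∶ A) = cong □∶_ (ren-id p A)
  renBdry-id p (A ≡ B by□) = cong₂ _≡_by□ (ren-id p A) (ren-id p B)
  renBdry-id p (s ≡ t ∶ A by□) = cong₃ _≡_∶_by□ (ren-id p s) (ren-id p t) (ren-id p A)

  renBBdry-id : {ρ : Ren {sig} γ γ} → ρ ≗ id → (bb : BBdry {sig} ms γ a) → renBBdry ρ bb ≡ bb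
  renBBdry-id p (bdry b) = cong bdry (renBdry-id p b)
  renBBdry-id p (babs A bb) = cong₂ babs (ren-id p A) (renBBdry-id (λ { zero → refl ; (suc i) → cong suc (p i) }) bb)

  module _ (I : Inst {sig} ps 0 ms) where
    instBdry≡msubBdry : {ρ : Ren {sig} γ (γ + 0)} → (∀ i → ρ i ≡ i ↑ˡ 0)
                      → (b : Bdry {sig} ms γ cl) → instBdry I b ≡ renBdry ρ (msubBdry (instMSub I) b)
    instBdry≡msubBdry ρ-id □type = refl
    instBdry≡msubBdry ρ-id (□∶ A) = cong □∶_ (inst≡msub I ρ-id A)
    instBdry≡msubBdry ρ-id (A ≡ B by□) = cong₂ _≡_by□ (inst≡msub I ρ-id A) (inst≡msub I ρ-id B)
    instBdry≡msubBdry ρ-id (s ≡ t ∶ A by□) =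
      cong₃ _≡_∶_by□ (inst≡msub I ρ-id s) (inst≡msub I ρ-id t) (inst≡msub I ρ-id A)

    instBB≡renBBdry-msubBBdry : {ρ : Ren {sig} γ (γ + 0)} → (∀ i → ρ i ≡ i ↑ˡ 0)
                              → (bb : BBdry {sig} ms γ a) → instBB I bb ≡ renBBdry ρ (msubBBdry (instMSub I) bb)
    instBB≡renBBdry-msubBBdry ρ-id (bdry b) = cong bdry (instBdry≡msubBdry ρ-id b)
    instBB≡renBBdry-msubBBdry ρ-id (babs A bb) =
      cong₂ babs (inst≡msub I ρ-id A)
                 (instBB≡renBBdry-msubBBdry (λ { zero → refl ; (suc i) → cong suc (ρ-id i) }) bb)

    instBB≡msubBBdry : (bb : BBdry {sig} ms 0 a) → instBB I bb ≡ msubBBdry (instMSub I) bb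
    instBB≡msubBBdry bb = trans (instBB≡renBBdry-msubBBdry {ρ = id} (λ ()) bb) (renBBdry-id (λ _ → refl) _)

  instBB-genInst : (bb : BBdry {sig} ms 0 a) → instBB (genInst ms) bb ≡ bb
  instBB-genInst {ms = ms} bb = trans (instBB≡msubBBdry (genInst ms) bb) (msubBBdry-genInst bb)

  instBB-wkInst : (I : Inst {sig} ps γ ms) (bb : BBdry {sig} ms δ a)
                → instBB (wkInst {b = b} I) bb ≡ mrenBB there (instBB I bb)
  instBB-wkInst I bb = begin
    instBB (wkInst I) bb                          ≡⟨ cong (λ J → instBB J bb) (wkInst≡msubInst I) ⟩
    instBB (msubInst (renMSub there) I) bb        ≡⟨ msubBBdry-instBB (renMSub-commutes there) I bb ⟨
    msubBBdry (renMSub there) (instBB I bb)       ≡⟨ mrenBB≡msubBBdry there (instBB I bb) ⟨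
    mrenBB there (instBB I bb)                    ∎

  genCtx-id : (Ξ : MCtx {sig} ms) → genCtx Ξ ≡ Ξ
  genCtx-id ∅ = refl
  genCtx-id (Ξ ▷ bb) = cong₂ _▷_ (genCtx-id Ξ) (instBB-genInst bb)

  renMSub-mvHead : (μ : MRen {sig} ms ps) (M : MVar ms (cl , n)) (ts : Terms ms γ n)
                 → msubArg (renMSub μ) (mvHead M ts) ≡ mvHead (μ M) (msubVec (renMSub μ) ts)
  renMSub-mvHead {cl = obj c} μ M ts = refl
  renMSub-mvHead {cl = eq c} μ M ts = refl

  instMSub-mvHead : (I : Inst {sig} ps 0 ms) (M : MVar ms (cl , n)) (ts : Terms ms γ n)
                  → msubArg (instMSub I) (mvHead M ts) ≡ applyArg (lookupI I M) noVars (msubVec (instMSub I) ts)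
  instMSub-mvHead {cl = obj c} I M ts = ≡sym (applyArg-obj (lookupI I M) noVars _)
  instMSub-mvHead {cl = eq c} I M ts = ≡sym (applyArg-eq (lookupI I M) noVars _)

  module Derivability (T : RawTheory {sig}) where
    open RawTheory T
    open RawRule

    private variable
      Θ : MCtx {sig} ms
      Γ Δ : VCtx {sig} ms γ

    castDer : {g g′ : Goal {sig} ms γ} → g ≡ g′ → Der T Θ Γ g → Der T Θ Γ g′
    castDer refl d = d

    castDers : {gs gs′ : List (Goal {sig} ms γ)} → gs ≡ gs′ → All (Der T Θ Γ) gs → All (Der T Θ Γ) gs′
    castDers refl ds = ds

    -- Admissibility of substitution

    -- Parametrised by the notion of well-typed substitution: renamings are an instance needed to
    -- weaken, which in turn is needed to lift well-typed substitutions.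
    module Substitution
      (WellTyped : ∀ {ms γ δ} → MCtx {sig} ms → VCtx {sig} ms γ → VCtx {sig} ms δ → Sub {sig} ms γ δ → Set)
      (wellTyped-var : ∀ {ms γ δ} {Θ : MCtx {sig} ms} {Γ : VCtx {sig} ms γ} {Δ : VCtx {sig} ms δ} {σ : Sub {sig} ms γ δ}
                     → WellTyped Θ Γ Δ σ → ∀ i → Der T Θ Δ (J₀ (hasType (σ i) (sub σ (lookupTy Γ i)))))
      (wellTyped-lift : ∀ {ms γ δ} {Θ : MCtx {sig} ms} {Γ : VCtx {sig} ms γ} {Δ : VCtx {sig} ms δ} {σ : Sub {sig} ms γ δ}
                      → WellTyped Θ Γ Δ σ → (A : Expr {sig} ms γ ty) → WellTyped Θ (Γ ▷ A) (Δ ▷ sub σ A) (liftS σ))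
      where

      subDer  : {σ : Sub {sig} ms γ δ} {g : Goal {sig} ms γ} → Der T Θ Γ g → WellTyped Θ Γ Δ σ → Der T Θ Δ (subGoal σ g)
      subDers : {σ : Sub {sig} ms γ δ} {gs : List (Goal {sig} ms γ)}
              → All (Der T Θ Γ) gs → WellTyped Θ Γ Δ σ → All (Der T Θ Δ) (map (subGoal σ) gs)
      subDers [] w = []
      subDers (d ∷ ds) w = subDer d w ∷ subDers ds w

      subDer (TT-Var i) w = wellTyped-var w i
      subDer {Θ = Θ} {σ = σ} (TT-Meta M ts args bd) w =
        castDer (cong J₀ (≡sym (trans (subJudg-fill₀ σ _ (mvHead M ts))
                                      (cong₂ fill₀ (subBdry-metaBdry sub-noVars (lookupM Θ M) ts) (subArg-mvHead M σ ts)))))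
          (TT-Meta M (subVec σ ts)
            (castDers (sub-metaArgGoals sub-noVars (lookupM Θ M) ts) (subDers args w))
            (castDer (cong B₀ (subBdry-metaBdry sub-noVars (lookupM Θ M) ts)) (subDer bd w)))
      subDer {Θ = Θ} {σ = σ} (TT-Meta-Congr M ss ts argss argst eqs bds bdt beq) w =
        castDer (cong J₀ (≡sym (trans (subJudg-fillEq₀ σ _ (mv M ss) (mv M ts))
                                      (cong (λ b → fillEq₀ b _ _) (subBdry-metaBdry sub-noVars (lookupM Θ M) ss)))))
          (TT-Meta-Congr M (subVec σ ss) (subVec σ ts)
            (castDers (sub-metaArgGoals sub-noVars (lookupM Θ M) ss) (subDers argss w))
            (castDers (sub-metaArgGoals sub-noVars (lookupM Θ M) ts) (subDers argst w))
            (castDers (sub-eqArgGoals sub-noVars (lookupM Θ M) ss ts) (subDers eqs w))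
            (castDer (cong B₀ (subBdry-metaBdry sub-noVars (lookupM Θ M) ss)) (subDer bds w))
            (castDer (cong B₀ (subBdry-metaBdry sub-noVars (lookupM Θ M) ts)) (subDer bdt w))
            (castDers (trans (sub-bdryEqGoals σ _ _) (cong₂ bdryEqGoals (subBdry-metaBdry sub-noVars (lookupM Θ M) ss)
                                                                         (subBdry-metaBdry sub-noVars (lookupM Θ M) ts)))
                      (subDers beq w)))
      subDer (TT-Abstr {A = A} dA dj) w = TT-Abstr (subDer dA w) (subDer dj (wellTyped-lift w A))
      subDer (TT-EqTy-Refl d) w = TT-EqTy-Refl (subDer d w)
      subDer (TT-EqTy-Sym d) w = TT-EqTy-Sym (subDer d w)
      subDer (TT-EqTy-Trans d d′) w = TT-EqTy-Trans (subDer d w) (subDer d′ w)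
      subDer (TT-EqTm-Refl d) w = TT-EqTm-Refl (subDer d w)
      subDer (TT-EqTm-Sym d) w = TT-EqTm-Sym (subDer d w)
      subDer (TT-EqTm-Trans d d′) w = TT-EqTm-Trans (subDer d w) (subDer d′ w)
      subDer (TT-Conv-Tm d d′) w = TT-Conv-Tm (subDer d w) (subDer d′ w)
      subDer (TT-Conv-EqTm d d′) w = TT-Conv-EqTm (subDer d w) (subDer d′ w)
      subDer TT-Bdry-Ty w = TT-Bdry-Ty
      subDer (TT-Bdry-Tm d) w = TT-Bdry-Tm (subDer d w)
      subDer (TT-Bdry-EqTy d d′) w = TT-Bdry-EqTy (subDer d w) (subDer d′ w)
      subDer (TT-Bdry-EqTm d d′ d″) w = TT-Bdry-EqTm (subDer d w) (subDer d′ w) (subDer d″ w)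
      subDer (TT-Bdry-Abstr {A = A} dA db) w = TT-Bdry-Abstr (subDer dA w) (subDer db (wellTyped-lift w A))
      subDer {σ = σ} (TT-Specific r I prems bd) w =
        castDer (cong J₀ (≡sym (subJudg-instJudg σ I (conclusion (rule r)))))
          (TT-Specific r (subInst σ I)
            (castDers (sub-instPrems σ (premises (rule r)) I) (subDers prems w))
            (castDer (cong B₀ (subBdry-instBdry₀ σ I (bdryOf (conclusion (rule r))))) (subDer bd w)))
      subDer {σ = σ} (TT-Congr r o I J premsI premsJ cps bdI bdJ extra) w =
        castDer (cong J₀ (≡sym (subJudg-congConcl σ (conclusion (rule r)) o I J)))
          (TT-Congr r o (subInst σ I) (subInst σ J)
            (castDers (sub-instPrems σ (premises (rule r)) I) (subDers premsI w))
            (castDers (sub-instPrems σ (premises (rule r)) J) (subDers premsJ w))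
            (castDers (sub-congPrems σ (premises (rule r)) I J) (subDers cps w))
            (castDer (cong B₀ (subBdry-instBdry₀ σ I (bdryOf (conclusion (rule r))))) (subDer bdI w))
            (castDer (cong B₀ (subBdry-instBdry₀ σ J (bdryOf (conclusion (rule r))))) (subDer bdJ w))
            (castDers (sub-congExtra σ (conclusion (rule r)) I J) (subDers extra w)))

    record WellTypedRen (Θ : MCtx {sig} ms) (Γ : VCtx {sig} ms γ) (Δ : VCtx {sig} ms δ) (σ : Sub {sig} ms γ δ) : Set where
      constructor wellTypedRen
      field
        mapVar : Ren {sig} γ δ
        is-renaming : σ ≗ varSub mapVar
        preserves-types : ∀ i → lookupTy Δ (mapVar i) ≡ sub σ (lookupTy Γ i)

    wellTypedRen-var : {σ : Sub {sig} ms γ δ} → WellTypedRen Θ Γ Δ σ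
                     → ∀ i → Der T Θ Δ (J₀ (hasType (σ i) (sub σ (lookupTy Γ i))))
    wellTypedRen-var (wellTypedRen ρ σ≗ρ types) i =
      castDer (cong J₀ (cong₂ hasType (≡sym (σ≗ρ i)) (types i))) (TT-Var (ρ i))

    wellTypedRen-lift : {σ : Sub {sig} ms γ δ} → WellTypedRen Θ Γ Δ σ
                      → (A : Expr {sig} ms γ ty) → WellTypedRen Θ (Γ ▷ A) (Δ ▷ sub σ A) (liftS σ)
    wellTypedRen-lift {Γ = Γ} {σ = σ} (wellTypedRen ρ σ≗ρ types) A = wellTypedRen (liftR {sig} ρ)
      (λ { zero → refl ; (suc i) → cong (ren suc) (σ≗ρ i) })
      (λ { zero → ≡sym (liftS-ren-suc σ A)
         ; (suc i) → trans (cong (ren suc) (types i)) (≡sym (liftS-ren-suc σ (lookupTy Γ i))) })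

    module RenDer = Substitution WellTypedRen wellTypedRen-var wellTypedRen-lift

    weakenDer : {X : Expr {sig} ms γ ty} {g : Goal {sig} ms γ} → Der T Θ Γ g → Der T Θ (Γ ▷ X) (subGoal (varSub suc) g)
    weakenDer {Γ = Γ} d = RenDer.subDer d (wellTypedRen suc (λ _ → refl) (λ i → ren≡sub suc (lookupTy Γ i)))

    weaken-hasType : {X : Expr {sig} ms γ ty} {t : Expr {sig} ms γ tm} {A : Expr {sig} ms γ ty}
                   → Der T Θ Γ (J₀ (hasType t A)) → Der T Θ (Γ ▷ X) (J₀ (hasType (ren suc t) (ren suc A)))
    weaken-hasType {t = t} {A} d =
      castDer (cong J₀ (cong₂ hasType (≡sym (ren≡sub suc t)) (≡sym (ren≡sub suc A)))) (weakenDer d)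

    weaken-eqType : {X : Expr {sig} ms γ ty} {A B : Expr {sig} ms γ ty}
                  → Der T Θ Γ (J₀ (eqType A B)) → Der T Θ (Γ ▷ X) (J₀ (eqType (ren suc A) (ren suc B)))
    weaken-eqType {A = A} {B} d =
      castDer (cong J₀ (cong₂ eqType (≡sym (ren≡sub suc A)) (≡sym (ren≡sub suc B)))) (weakenDer d)

    weaken-eqTerm : {X : Expr {sig} ms γ ty} {s t : Expr {sig} ms γ tm} {A : Expr {sig} ms γ ty}
                  → Der T Θ Γ (J₀ (eqTerm s t A)) → Der T Θ (Γ ▷ X) (J₀ (eqTerm (ren suc s) (ren suc t) (ren suc A)))
    weaken-eqTerm {s = s} {t} {A} d =
      castDer (cong J₀ (cong₃ eqTerm (≡sym (ren≡sub suc s)) (≡sym (ren≡sub suc t)) (≡sym (ren≡sub suc A)))) (weakenDer d)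

    record WellTypedSub (Θ : MCtx {sig} ms) (Γ : VCtx {sig} ms γ) (Δ : VCtx {sig} ms δ) (σ : Sub {sig} ms γ δ) : Set where
      constructor wellTypedSub
      field
        typed : ∀ i → Der T Θ Δ (J₀ (hasType (σ i) (sub σ (lookupTy Γ i))))
    open WellTypedSub

    wellTypedSub-lift : {σ : Sub {sig} ms γ δ} → WellTypedSub Θ Γ Δ σ
                      → (A : Expr {sig} ms γ ty) → WellTypedSub Θ (Γ ▷ A) (Δ ▷ sub σ A) (liftS σ)
    wellTypedSub-lift {Γ = Γ} {σ = σ} w A = wellTypedSub λ where
      zero → castDer (cong J₀ (cong (hasType (var zero)) (≡sym (liftS-ren-suc σ A)))) (TT-Var zero)
      (suc i) → castDer (cong J₀ (cong (hasType _) (≡sym (liftS-ren-suc σ (lookupTy Γ i)))))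
                        (weaken-hasType (typed w i))

    open Substitution WellTypedSub typed wellTypedSub-lift

    -- Equality substitution

    -- SubEq Θ Δ σ σ′ g is the equation between the σ- and σ′-instances of an object judgement g
    -- (trivial for other goals); it is derivable when g is and σ, σ′ are judgementally equal.
    eqJJudg : JJudg {sig} ms γ (obj c , n) → Sub {sig} ms γ δ → Sub {sig} ms γ δ → JJudg {sig} ms δ (eq c , n)
    eqJJudg (judg (isType A)) σ σ′ = judg (eqType (sub σ A) (sub σ′ A))
    eqJJudg (judg (hasType t A)) σ σ′ = judg (eqTerm (sub σ t) (sub σ′ t) (sub σ A))
    eqJJudg (jabs A j) σ σ′ = jabs (sub σ A) (eqJJudg j (liftS σ) (liftS σ′))

    SubEq : MCtx {sig} ms → VCtx {sig} ms δ → Sub {sig} ms γ δ → Sub {sig} ms γ δ → Goal {sig} ms γ → Set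
    SubEq Θ Δ σ σ′ (jdg {obj c , n} j) = Der T Θ Δ (jdg (eqJJudg j σ σ′))
    SubEq Θ Δ σ σ′ (jdg {eq c , n} j) = ⊤
    SubEq Θ Δ σ σ′ (bdy b) = ⊤

    record EqualSubs (Θ : MCtx {sig} ms) (Γ : VCtx {sig} ms γ) (Δ : VCtx {sig} ms δ) (σ σ′ : Sub {sig} ms γ δ) : Set where
      constructor equalSubs
      field
        left  : WellTypedSub Θ Γ Δ σ
        right : WellTypedSub Θ Γ Δ σ′
        equal : ∀ i → Der T Θ Δ (J₀ (eqTerm (σ i) (σ′ i) (sub σ (lookupTy Γ i))))
    open EqualSubs

    -- The new variable is typed by σ A on both sides; on the right it is converted to σ′ A.
    equalSubs-lift : {σ σ′ : Sub {sig} ms γ δ} → EqualSubs Θ Γ Δ σ σ′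
                   → (A : Expr {sig} ms γ ty) → Der T Θ Δ (J₀ (eqType (sub σ A) (sub σ′ A)))
                   → EqualSubs Θ (Γ ▷ A) (Δ ▷ sub σ A) (liftS σ) (liftS σ′)
    equalSubs-lift {Γ = Γ} {σ = σ} {σ′} w A σA≡σ′A = equalSubs
      (wellTypedSub-lift (left w) A)
      (wellTypedSub λ where
        zero → castDer (cong J₀ (cong (hasType _) (≡sym (liftS-ren-suc σ′ A))))
                       (TT-Conv-Tm (TT-Var zero) (weaken-eqType σA≡σ′A))
        (suc i) → castDer (cong J₀ (cong (hasType _) (≡sym (liftS-ren-suc σ′ (lookupTy Γ i)))))
                          (weaken-hasType (typed (right w) i)))
      (λ where
        zero → TT-EqTm-Refl (typed (wellTypedSub-lift (left w) A) zero)
        (suc i) → castDer (cong J₀ (cong (eqTerm _ _) (≡sym (liftS-ren-suc σ (lookupTy Γ i)))))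
                          (weaken-eqTerm (equal w i)))

    subEq-fillEq : {σ σ′ : Sub {sig} ms γ δ} (b : Bdry {sig} ms γ (obj c)) (x : Expr {sig} ms γ c)
                 → Der T Θ Δ (J₀ (fillEq₀ (subBdry σ b) (sub σ x) (sub σ′ x))) → SubEq Θ Δ σ σ′ (J₀ (fill₀ b (expr x)))
    subEq-fillEq □type x d = d
    subEq-fillEq (□∶ A) x d = d

    fillEq-subEq : {σ σ′ : Sub {sig} ms γ δ} (b : Bdry {sig} ms γ (obj c)) (x : Expr {sig} ms γ c)
                 → SubEq Θ Δ σ σ′ (J₀ (fill₀ b (expr x))) → Der T Θ Δ (J₀ (fillEq₀ (subBdry σ b) (sub σ x) (sub σ′ x)))
    fillEq-subEq □type x d = d
    fillEq-subEq (□∶ A) x d = d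

    eqJJudg-fill : (bb : BBdry {sig} ms γ (obj c , n)) (e : Arg {sig} ms γ (obj c , n)) (σ σ′ : Sub {sig} ms γ δ)
                 → eqJJudg (fill bb e) σ σ′ ≡ fillEq (subBBdry σ bb) (subArg σ e) (subArg σ′ e)
    eqJJudg-fill (bdry □type) (expr x) σ σ′ = refl
    eqJJudg-fill (bdry (□∶ A)) (expr x) σ σ′ = refl
    eqJJudg-fill (babs A bb) (abs e) σ σ′ = cong (jabs _) (eqJJudg-fill bb e (liftS σ) (liftS σ′))

    subEq-congConcl : {σ σ′ : Sub {sig} ms γ δ} (j : Judg {sig} sh 0 cl) (o : IsObj {sig} cl) (I J : Inst {sig} ms γ sh)
                    → SubEq Θ Δ σ σ′ (J₀ (congConcl j o I J))
    subEq-congConcl (isType A) o I J = tt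
    subEq-congConcl (hasType t A) o I J = tt

    CongruenceRule : MCtx {sig} ms → VCtx {sig} ms δ → MCtx {sig} sh → Judg {sig} sh 0 cl → Set
    CongruenceRule {ms} {δ} {sh} {cl} Θ Δ Ξ j =
      (o : IsObj {sig} cl) (I J : Inst {sig} ms δ sh)
      → All (Der T Θ Δ) (instPrems Ξ I) → All (Der T Θ Δ) (instPrems Ξ J) → All (Der T Θ Δ) (congPrems Ξ I J)
      → Der T Θ Δ (B₀ (instBdry I (bdryOf j))) → Der T Θ Δ (B₀ (instBdry J (bdryOf j)))
      → All (Der T Θ Δ) (congExtra j I J) → Der T Θ Δ (J₀ (congConcl j o I J))

    eqSubDer           : {σ σ′ : Sub {sig} ms γ δ} {g : Goal {sig} ms γ}
                       → Der T Θ Γ g → EqualSubs Θ Γ Δ σ σ′ → SubEq Θ Δ σ σ′ g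
    eqSubDer-eqArgGoals : {σ σ′ : Sub {sig} ms γ δ} (bb : BBdry {sig} ms ε (cl , n))
                          {τ : Sub {sig} ms ε γ} {θ : Sub {sig} ms ε δ} → sub σ ∘ τ ≗ θ → (ts : Terms ms γ n)
                        → All (Der T Θ Γ) (metaArgGoals bb τ ts) → EqualSubs Θ Γ Δ σ σ′
                        → All (Der T Θ Δ) (eqArgGoals bb θ (subVec σ ts) (subVec σ′ ts))
    eqSubDer-bdryEqGoals : {σ σ′ : Sub {sig} ms γ δ} (b : Bdry {sig} ms γ (obj c))
                         → Der T Θ Γ (B₀ b) → EqualSubs Θ Γ Δ σ σ′
                         → All (Der T Θ Δ) (bdryEqGoals (subBdry σ b) (subBdry σ′ b))
    eqSubDer-congPrems : {σ σ′ : Sub {sig} ms γ δ} (Ξ : MCtx {sig} sh) (I : Inst {sig} ms γ sh)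
                       → All (Der T Θ Γ) (instPrems Ξ I) → EqualSubs Θ Γ Δ σ σ′
                       → All (Der T Θ Δ) (congPrems Ξ (subInst σ I) (subInst σ′ I))
    eqSubDer-specific  : {σ σ′ : Sub {sig} ms γ δ} (Ξ : MCtx {sig} sh) (j : Judg {sig} sh 0 cl) (I : Inst {sig} ms γ sh)
                       → All (Der T Θ Γ) (instPrems Ξ I) → Der T Θ Γ (B₀ (instBdry I (bdryOf j))) → EqualSubs Θ Γ Δ σ σ′
                       → CongruenceRule Θ Δ Ξ j → SubEq Θ Δ σ σ′ (J₀ (instJudg I j))

    eqSubDer (TT-Var i) w = equal w i
    eqSubDer {Θ = Θ} {σ = σ} {σ′} (TT-Meta {cl = obj c} M ts args bd) w =
      subEq-fillEq (metaBdry (lookupM Θ M) noVars ts) (mv M ts)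
        (castDer (cong J₀ (cong (λ b → fillEq₀ b _ _) (≡sym (bdry-ts σ))))
          (TT-Meta-Congr M (subVec σ ts) (subVec σ′ ts)
            (castDers (sub-metaArgGoals sub-noVars (lookupM Θ M) ts) (subDers args (left w)))
            (castDers (sub-metaArgGoals sub-noVars (lookupM Θ M) ts) (subDers args (right w)))
            (eqSubDer-eqArgGoals (lookupM Θ M) sub-noVars ts args w)
            (castDer (cong B₀ (bdry-ts σ)) (subDer bd (left w)))
            (castDer (cong B₀ (bdry-ts σ′)) (subDer bd (right w)))
            (castDers (cong₂ bdryEqGoals (bdry-ts σ) (bdry-ts σ′))
                      (eqSubDer-bdryEqGoals (metaBdry (lookupM Θ M) noVars ts) bd w))))
      where
      bdry-ts : (τ : Sub {sig} _ _ _)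
              → subBdry τ (metaBdry (lookupM Θ M) noVars ts) ≡ metaBdry (lookupM Θ M) noVars (subVec τ ts)
      bdry-ts τ = subBdry-metaBdry sub-noVars (lookupM Θ M) ts
    eqSubDer (TT-Meta {cl = eq c} M ts args bd) w = tt
    eqSubDer (TT-Meta-Congr M ss ts argss argst eqs bds bdt beq) w = tt
    eqSubDer (TT-Abstr {A = A} {a = obj c , n} dA dj) w =
      TT-Abstr (subDer dA (left w)) (eqSubDer dj (equalSubs-lift w A (eqSubDer dA w)))
    eqSubDer (TT-Abstr {a = eq c , n} dA dj) w = tt
    eqSubDer (TT-EqTy-Refl d) w = tt
    eqSubDer (TT-EqTy-Sym d) w = tt
    eqSubDer (TT-EqTy-Trans d d′) w = tt
    eqSubDer (TT-EqTm-Refl d) w = tt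
    eqSubDer (TT-EqTm-Sym d) w = tt
    eqSubDer (TT-EqTm-Trans d d′) w = tt
    eqSubDer (TT-Conv-Tm d d′) w = TT-Conv-EqTm (eqSubDer d w) (subDer d′ (left w))
    eqSubDer (TT-Conv-EqTm d d′) w = tt
    eqSubDer TT-Bdry-Ty w = tt
    eqSubDer (TT-Bdry-Tm d) w = tt
    eqSubDer (TT-Bdry-EqTy d d′) w = tt
    eqSubDer (TT-Bdry-EqTm d d′ d″) w = tt
    eqSubDer (TT-Bdry-Abstr dA db) w = tt
    eqSubDer (TT-Specific r I prems bd) w =
      eqSubDer-specific (premises (rule r)) (conclusion (rule r)) I prems bd w (TT-Congr r)
    eqSubDer (TT-Congr r o I J premsI premsJ cps bdI bdJ extra) w = subEq-congConcl (conclusion (rule r)) o I J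

    eqSubDer-eqArgGoals (bdry b) p [] [] w = []
    eqSubDer-eqArgGoals (babs A bb) p (t ∷ ts) (d ∷ ds) w =
      castDer (cong J₀ (cong (eqTerm _ _) (sub-sub p A))) (eqSubDer d w) ∷ eqSubDer-eqArgGoals bb (sub-▸ p t) ts ds w

    eqSubDer-bdryEqGoals □type d w = []
    eqSubDer-bdryEqGoals (□∶ C) (TT-Bdry-Tm dC) w = eqSubDer dC w ∷ []

    eqSubDer-congPrems ∅ [] [] w = []
    eqSubDer-congPrems {σ = σ} {σ′} (_▷_ {a = obj c , n} Ξ bb) (e ∷ I) (d ∷ ds) w =
      castDer (cong jdg (trans (eqJJudg-fill (instBB I bb) e σ σ′)
                               (cong (λ X → fillEq X _ _) (subBBdry-instBB σ I (IsLift-zero σ I) bb))))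
              (eqSubDer d w)
      ∷ eqSubDer-congPrems Ξ I ds w
    eqSubDer-congPrems (_▷_ {a = eq c , n} Ξ bb) (e ∷ I) (d ∷ ds) w = eqSubDer-congPrems Ξ I ds w

    eqSubDer-specific {σ = σ} {σ′} Ξ (isType A) I prems bd w congr =
      castDer (cong J₀ (cong₂ eqType (≡sym (sub-inst₀ σ I A)) (≡sym (sub-inst₀ σ′ I A))))
        (congr tt (subInst σ I) (subInst σ′ I)
          (castDers (sub-instPrems σ Ξ I) (subDers prems (left w)))
          (castDers (sub-instPrems σ′ Ξ I) (subDers prems (right w)))
          (eqSubDer-congPrems Ξ I prems w)
          TT-Bdry-Ty TT-Bdry-Ty [])
    eqSubDer-specific {σ = σ} {σ′} Ξ (hasType t A) I prems (TT-Bdry-Tm dA) w congr =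
      castDer (cong J₀ (cong₃ eqTerm (≡sym (sub-inst₀ σ I t)) (≡sym (sub-inst₀ σ′ I t)) (≡sym (sub-inst₀ σ I A))))
        (congr tt (subInst σ I) (subInst σ′ I)
          (castDers (sub-instPrems σ Ξ I) (subDers prems (left w)))
          (castDers (sub-instPrems σ′ Ξ I) (subDers prems (right w)))
          (eqSubDer-congPrems Ξ I prems w)
          (castDer (cong B₀ (cong □∶_ (sub-inst₀ σ I A))) (subDer (TT-Bdry-Tm dA) (left w)))
          (castDer (cong B₀ (cong □∶_ (sub-inst₀ σ′ I A))) (subDer (TT-Bdry-Tm dA) (right w)))
          (castDer (cong J₀ (cong₂ eqType (sub-inst₀ σ I A) (sub-inst₀ σ′ I A))) (eqSubDer dA w) ∷ []))
    eqSubDer-specific Ξ (eqType A B) I prems bd w congr = tt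
    eqSubDer-specific Ξ (eqTerm s t A) I prems bd w congr = tt

    -- Admissibility of instantiation

    applyArg-der : (bb : BBdry {sig} ms γ (cl , n)) (e : Arg {sig} ms γ (cl , n)) {σ : Sub {sig} ms γ δ}
                 → Der T Θ Γ (jdg (fill bb e)) → WellTypedSub Θ Γ Δ σ → (us : Terms ms δ n)
                 → All (Der T Θ Δ) (metaArgGoals bb σ us)
                 → Der T Θ Δ (J₀ (fill₀ (metaBdry bb σ us) (applyArg e σ us)))
    applyArg-der (bdry b) e {σ} d w [] [] =
      castDer (cong J₀ (trans (subJudg-fill₀ σ b e) (cong (fill₀ _) (≡sym (applyArg-[] e σ))))) (subDer d w)
    applyArg-der {Γ = Γ} (babs A bb) (abs e) (TT-Abstr _ d) w (u ∷ us) (du ∷ dus) = applyArg-der bb e d w′ us dus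
      where
      w′ : WellTypedSub _ (Γ ▷ A) _ (u ▸ _)
      w′ = wellTypedSub λ where
        zero → castDer (cong J₀ (cong (hasType u) (≡sym (sub-ren (λ _ → refl) A)))) du
        (suc i) → castDer (cong J₀ (cong (hasType _) (≡sym (sub-ren (λ _ → refl) (lookupTy Γ i))))) (typed w i)

    apply-eq-der : (bb : BBdry {sig} ms γ (obj c , n)) (e : Arg {sig} ms γ (obj c , n)) {σ σ′ : Sub {sig} ms γ δ}
                 → Der T Θ Γ (jdg (fill bb e)) → EqualSubs Θ Γ Δ σ σ′ → (us us′ : Terms ms δ n)
                 → All (Der T Θ Δ) (metaArgGoals bb σ us) → All (Der T Θ Δ) (metaArgGoals bb σ′ us′)
                 → All (Der T Θ Δ) (eqArgGoals bb σ us us′)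
                 → Der T Θ Δ (J₀ (fillEq₀ (metaBdry bb σ us) (apply e σ us) (apply e σ′ us′)))
    apply-eq-der (bdry b) (expr x) d w [] [] [] [] [] = fillEq-subEq b x (eqSubDer d w)
    apply-eq-der {Γ = Γ} (babs A bb) (abs e) (TT-Abstr _ d) w
                 (u ∷ us) (u′ ∷ us′) (du ∷ dus) (du′ ∷ dus′) (du≡ ∷ dus≡) =
      apply-eq-der bb e d w′ us us′ dus dus′ dus≡
      where
      shift : (τ : Sub {sig} _ _ _) (t : Expr {sig} _ _ tm) (X : Expr {sig} _ _ ty) → sub τ X ≡ sub (t ▸ τ) (ren suc X)
      shift τ t X = ≡sym (sub-ren (λ _ → refl) X)
      w′ : EqualSubs _ (Γ ▷ A) _ (u ▸ _) (u′ ▸ _)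
      w′ = equalSubs
        (wellTypedSub λ where
          zero → castDer (cong J₀ (cong (hasType u) (shift _ u A))) du
          (suc i) → castDer (cong J₀ (cong (hasType _) (shift _ u (lookupTy Γ i)))) (typed (left w) i))
        (wellTypedSub λ where
          zero → castDer (cong J₀ (cong (hasType u′) (shift _ u′ A))) du′
          (suc i) → castDer (cong J₀ (cong (hasType _) (shift _ u′ (lookupTy Γ i)))) (typed (right w) i))
        (λ where
          zero → castDer (cong J₀ (cong (eqTerm u u′) (shift _ u A))) du≡
          (suc i) → castDer (cong J₀ (cong (eqTerm _ _) (shift _ u (lookupTy Γ i)))) (equal w i))

    record RespectsMetaRules (φ : MSub ms ps) (Θ : MCtx {sig} ms) (Θ′ : MCtx {sig} ps) : Set where
      field
        meta : {Γ : VCtx {sig} ms γ} (M : MVar ms (cl , n)) (ts : Terms ms γ n)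
             → All (Der T Θ′ (msubCtx φ Γ)) (map (msubGoal φ) (metaArgGoals (lookupM Θ M) noVars ts))
             → Der T Θ′ (msubCtx φ Γ) (msubGoal φ (B₀ (metaBdry (lookupM Θ M) noVars ts)))
             → Der T Θ′ (msubCtx φ Γ) (msubGoal φ (J₀ (fill₀ (metaBdry (lookupM Θ M) noVars ts) (mvHead M ts))))
        meta-congr : {Γ : VCtx {sig} ms γ} (M : MVar ms (obj c , n)) (ss ts : Terms ms γ n)
             → All (Der T Θ′ (msubCtx φ Γ)) (map (msubGoal φ) (metaArgGoals (lookupM Θ M) noVars ss))
             → All (Der T Θ′ (msubCtx φ Γ)) (map (msubGoal φ) (metaArgGoals (lookupM Θ M) noVars ts))
             → All (Der T Θ′ (msubCtx φ Γ)) (map (msubGoal φ) (eqArgGoals (lookupM Θ M) noVars ss ts))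
             → Der T Θ′ (msubCtx φ Γ) (msubGoal φ (B₀ (metaBdry (lookupM Θ M) noVars ss)))
             → Der T Θ′ (msubCtx φ Γ) (msubGoal φ (B₀ (metaBdry (lookupM Θ M) noVars ts)))
             → All (Der T Θ′ (msubCtx φ Γ))
                   (map (msubGoal φ) (bdryEqGoals (metaBdry (lookupM Θ M) noVars ss) (metaBdry (lookupM Θ M) noVars ts)))
             → Der T Θ′ (msubCtx φ Γ) (msubGoal φ (J₀ (fillEq₀ (metaBdry (lookupM Θ M) noVars ss) (mv M ss) (mv M ts))))

    module _ {φ : MSub ms ps} (φ-sub : CommutesWithSub φ) {Θ : MCtx {sig} ms} {Θ′ : MCtx {sig} ps}
             (respects : RespectsMetaRules φ Θ Θ′) where
      open RespectsMetaRules respects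

      msubDer  : {g : Goal {sig} ms γ} → Der T Θ Γ g → Der T Θ′ (msubCtx φ Γ) (msubGoal φ g)
      msubDers : {gs : List (Goal {sig} ms γ)} → All (Der T Θ Γ) gs → All (Der T Θ′ (msubCtx φ Γ)) (map (msubGoal φ) gs)
      msubDers [] = []
      msubDers (d ∷ ds) = msubDer d ∷ msubDers ds

      msubDer {Γ = Γ} (TT-Var i) = castDer (cong J₀ (cong (hasType _) (lookupTy-msubCtx φ-sub Γ i))) (TT-Var i)
      msubDer (TT-Meta M ts args bd) = meta M ts (msubDers args) (msubDer bd)
      msubDer (TT-Meta-Congr M ss ts argss argst eqs bds bdt beq) =
        meta-congr M ss ts (msubDers argss) (msubDers argst) (msubDers eqs) (msubDer bds) (msubDer bdt) (msubDers beq)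
      msubDer (TT-Abstr dA dj) = TT-Abstr (msubDer dA) (msubDer dj)
      msubDer (TT-EqTy-Refl d) = TT-EqTy-Refl (msubDer d)
      msubDer (TT-EqTy-Sym d) = TT-EqTy-Sym (msubDer d)
      msubDer (TT-EqTy-Trans d d′) = TT-EqTy-Trans (msubDer d) (msubDer d′)
      msubDer (TT-EqTm-Refl d) = TT-EqTm-Refl (msubDer d)
      msubDer (TT-EqTm-Sym d) = TT-EqTm-Sym (msubDer d)
      msubDer (TT-EqTm-Trans d d′) = TT-EqTm-Trans (msubDer d) (msubDer d′)
      msubDer (TT-Conv-Tm d d′) = TT-Conv-Tm (msubDer d) (msubDer d′)
      msubDer (TT-Conv-EqTm d d′) = TT-Conv-EqTm (msubDer d) (msubDer d′)
      msubDer TT-Bdry-Ty = TT-Bdry-Ty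
      msubDer (TT-Bdry-Tm d) = TT-Bdry-Tm (msubDer d)
      msubDer (TT-Bdry-EqTy d d′) = TT-Bdry-EqTy (msubDer d) (msubDer d′)
      msubDer (TT-Bdry-EqTm d d′ d″) = TT-Bdry-EqTm (msubDer d) (msubDer d′) (msubDer d″)
      msubDer (TT-Bdry-Abstr dA db) = TT-Bdry-Abstr (msubDer dA) (msubDer db)
      msubDer (TT-Specific r I prems bd) =
        castDer (cong J₀ (≡sym (msubJudg-instJudg φ-sub I (conclusion (rule r)))))
          (TT-Specific r (msubInst φ I)
            (castDers (msub-instPrems φ-sub (premises (rule r)) I) (msubDers prems))
            (castDer (cong B₀ (msubBdry-instBdry φ-sub I (bdryOf (conclusion (rule r))))) (msubDer bd)))
      msubDer (TT-Congr r o I J premsI premsJ cps bdI bdJ extra) =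
        castDer (cong J₀ (≡sym (msubJudg-congConcl φ-sub (conclusion (rule r)) o I J)))
          (TT-Congr r o (msubInst φ I) (msubInst φ J)
            (castDers (msub-instPrems φ-sub (premises (rule r)) I) (msubDers premsI))
            (castDers (msub-instPrems φ-sub (premises (rule r)) J) (msubDers premsJ))
            (castDers (msub-congPrems φ-sub (premises (rule r)) I J) (msubDers cps))
            (castDer (cong B₀ (msubBdry-instBdry φ-sub I (bdryOf (conclusion (rule r))))) (msubDer bdI))
            (castDer (cong B₀ (msubBdry-instBdry φ-sub J (bdryOf (conclusion (rule r))))) (msubDer bdJ))
            (castDers (msub-congExtra φ-sub (conclusion (rule r)) I J) (msubDers extra)))

    module _ (Θ : MCtx {sig} ms) (bb : BBdry {sig} ms 0 b) where
      private
        wk : MSub ms (b ∷ ms)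
        wk = renMSub there

        wk-sub : CommutesWithSub wk
        wk-sub = renMSub-commutes there

        lookupM-there : (M : MVar ms a) → msubBBdry wk (lookupM Θ M) ≡ lookupM (Θ ▷ bb) (there M)
        lookupM-there M = ≡sym (mrenBB≡msubBBdry there (lookupM Θ M))

        metaArgGoals-there : (M : MVar ms (cl , n)) (ts : Terms ms γ n)
                           → map (msubGoal wk) (metaArgGoals (lookupM Θ M) noVars ts)
                           ≡ metaArgGoals (lookupM (Θ ▷ bb) (there M)) noVars (msubVec wk ts)
        metaArgGoals-there M ts = trans (msub-metaArgGoals wk-sub (msub-noVars wk) (lookupM Θ M) ts)
                                        (cong (λ X → metaArgGoals X noVars (msubVec wk ts)) (lookupM-there M))

        metaBdry-there : (M : MVar ms (cl , n)) (ts : Terms ms γ n)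
                       → msubBdry wk (metaBdry (lookupM Θ M) noVars ts) ≡ metaBdry (lookupM (Θ ▷ bb) (there M)) noVars (msubVec wk ts)
        metaBdry-there M ts = trans (msubBdry-metaBdry wk-sub (msub-noVars wk) (lookupM Θ M) ts)
                                    (cong (λ X → metaBdry X noVars (msubVec wk ts)) (lookupM-there M))

        eqArgGoals-there : (M : MVar ms (cl , n)) (ss ts : Terms ms γ n)
                         → map (msubGoal wk) (eqArgGoals (lookupM Θ M) noVars ss ts)
                         ≡ eqArgGoals (lookupM (Θ ▷ bb) (there M)) noVars (msubVec wk ss) (msubVec wk ts)
        eqArgGoals-there M ss ts = trans (msub-eqArgGoals wk-sub (msub-noVars wk) (lookupM Θ M) ss ts)
                                         (cong (λ X → eqArgGoals X noVars (msubVec wk ss) (msubVec wk ts)) (lookupM-there M))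

        wk-respects : RespectsMetaRules wk Θ (Θ ▷ bb)
        wk-respects .RespectsMetaRules.meta M ts args bd =
          castDer (cong J₀ (≡sym (trans (msubJudg-fill₀ wk _ (mvHead M ts))
                                        (cong₂ fill₀ (metaBdry-there M ts) (renMSub-mvHead there M ts)))))
            (TT-Meta (there M) (msubVec wk ts) (castDers (metaArgGoals-there M ts) args)
                                               (castDer (cong B₀ (metaBdry-there M ts)) bd))
        wk-respects .RespectsMetaRules.meta-congr M ss ts argss argst eqs bds bdt beq =
          castDer (cong J₀ (≡sym (trans (msubJudg-fillEq₀ wk _ (mv M ss) (mv M ts))
                                        (cong (λ X → fillEq₀ X _ _) (metaBdry-there M ss)))))
            (TT-Meta-Congr (there M) (msubVec wk ss) (msubVec wk ts)
              (castDers (metaArgGoals-there M ss) argss) (castDers (metaArgGoals-there M ts) argst)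
              (castDers (eqArgGoals-there M ss ts) eqs)
              (castDer (cong B₀ (metaBdry-there M ss)) bds) (castDer (cong B₀ (metaBdry-there M ts)) bdt)
              (castDers (trans (msub-bdryEqGoals wk _ _) (cong₂ bdryEqGoals (metaBdry-there M ss) (metaBdry-there M ts)))
                        beq))

      mrenBB-there-der : {bb′ : BBdry {sig} ms 0 a} → Der T Θ ∅ (bdy bb′) → Der T (Θ ▷ bb) ∅ (bdy (mrenBB there bb′))
      mrenBB-there-der {bb′ = bb′} d =
        castDer (cong bdy (≡sym (mrenBB≡msubBBdry there bb′))) (msubDer wk-sub wk-respects d)

      wkInst-der : (Ξ : MCtx {sig} sh) (I : Inst {sig} ms 0 sh)
                 → DerivableInst T Θ ∅ Ξ I → DerivableInst T (Θ ▷ bb) ∅ Ξ (wkInst I)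
      wkInst-der Ξ I ds =
        castDers (trans (msub-instPrems wk-sub Ξ I) (cong (instPrems Ξ) (≡sym (wkInst≡msubInst I))))
                 (msubDers wk-sub wk-respects ds)

    module _ {Θ : MCtx {sig} ms} {Θ′ : MCtx {sig} ps} (I : Inst {sig} ps 0 ms)
             (lookup-der : ∀ {a} (M : MVar ms a)
                         → Der T Θ′ ∅ (jdg (fill (msubBBdry (instMSub I) (lookupM Θ M)) (lookupI I M))))
             where
      private
        ι : MSub ms ps
        ι = instMSub I

        ι-sub : CommutesWithSub ι
        ι-sub = instMSub-commutes I

        metaBdry-ι : (M : MVar ms (cl , n)) (ts : Terms ms γ n)
                   → msubBdry ι (metaBdry (lookupM Θ M) noVars ts) ≡ metaBdry (msubBBdry ι (lookupM Θ M)) noVars (msubVec ι ts)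
        metaBdry-ι M = msubBdry-metaBdry ι-sub (msub-noVars ι) (lookupM Θ M)

        metaArgGoals-ι : (M : MVar ms (cl , n)) (ts : Terms ms γ n)
                       → map (msubGoal ι) (metaArgGoals (lookupM Θ M) noVars ts)
                       ≡ metaArgGoals (msubBBdry ι (lookupM Θ M)) noVars (msubVec ι ts)
        metaArgGoals-ι M = msub-metaArgGoals ι-sub (msub-noVars ι) (lookupM Θ M)

      instantiation-respects : RespectsMetaRules ι Θ Θ′
      instantiation-respects .RespectsMetaRules.meta M ts args bd =
        castDer (cong J₀ (≡sym (trans (msubJudg-fill₀ ι _ (mvHead M ts))
                                      (cong₂ fill₀ (metaBdry-ι M ts) (instMSub-mvHead I M ts)))))
          (applyArg-der (msubBBdry ι (lookupM Θ M)) (lookupI I M) (lookup-der M) (wellTypedSub (λ ())) (msubVec ι ts)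
            (castDers (metaArgGoals-ι M ts) args))
      instantiation-respects .RespectsMetaRules.meta-congr M ss ts argss argst eqs bds bdt beq =
        castDer (cong J₀ (≡sym (trans (msubJudg-fillEq₀ ι _ (mv M ss) (mv M ts))
                                      (cong (λ X → fillEq₀ X _ _) (metaBdry-ι M ss)))))
          (apply-eq-der (msubBBdry ι (lookupM Θ M)) (lookupI I M) (lookup-der M)
            (equalSubs (wellTypedSub (λ ())) (wellTypedSub (λ ())) (λ ())) (msubVec ι ss) (msubVec ι ts)
            (castDers (metaArgGoals-ι M ss) argss) (castDers (metaArgGoals-ι M ts) argst)
            (castDers (msub-eqArgGoals ι-sub (msub-noVars ι) (lookupM Θ M) ss ts) eqs))

    lookupI-der : {Θ′ : MCtx {sig} ps} (Θ : MCtx {sig} ms) (I : Inst {sig} ps 0 ms) → DerivableInst T Θ′ ∅ Θ I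
                → (M : MVar ms a) → Der T Θ′ ∅ (jdg (fill (msubBBdry (instMSub I) (lookupM Θ M)) (lookupI I M)))
    lookupI-der (Θ ▷ bb) (e ∷ I) (d ∷ ds) here = castDer (cong (λ X → jdg (fill X e)) bdry≡) d
      where
      bdry≡ : instBB I bb ≡ msubBBdry (instMSub (e ∷ I)) (mrenBB there bb)
      bdry≡ = begin
        instBB I bb
          ≡⟨ instBB≡msubBBdry I bb ⟩
        msubBBdry (instMSub I) bb
          ≡⟨ msubBBdry-renMSub (instMSub (e ∷ I)) there bb ⟨
        msubBBdry (instMSub (e ∷ I)) (msubBBdry (renMSub there) bb)
          ≡⟨ cong (msubBBdry _) (mrenBB≡msubBBdry there bb) ⟨
        msubBBdry (instMSub (e ∷ I)) (mrenBB there bb) ∎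
    lookupI-der (Θ ▷ bb) (e ∷ I) (d ∷ ds) (there M) =
      castDer (cong (λ X → jdg (fill X _)) bdry≡) (lookupI-der Θ I ds M)
      where
      bdry≡ : msubBBdry (instMSub I) (lookupM Θ M) ≡ msubBBdry (instMSub (e ∷ I)) (mrenBB there (lookupM Θ M))
      bdry≡ = ≡sym (trans (cong (msubBBdry _) (mrenBB≡msubBBdry there (lookupM Θ M)))
                       (msubBBdry-renMSub (instMSub (e ∷ I)) there (lookupM Θ M)))

    instBB-der : {Θ′ : MCtx {sig} ps} (Θ : MCtx {sig} ms) (I : Inst {sig} ps 0 ms) → DerivableInst T Θ′ ∅ Θ I
               → {bb : BBdry {sig} ms 0 a} → Der T Θ ∅ (bdy bb) → Der T Θ′ ∅ (bdy (instBB I bb))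
    instBB-der Θ I ds {bb} d =
      castDer (cong bdy (≡sym (instBB≡msubBBdry I bb)))
              (msubDer (instMSub-commutes I) (instantiation-respects I (lookupI-der Θ I ds)) d)

    -- Generic applications

    -- The invariant of hatGo: its head k is derivable under every type-respecting renaming of the
    -- scope.  Abstracting one more variable preserves it, the bound variable being typed by TT-Var.
    record DerivableHead (Θ : MCtx {sig} ms) (Γ : VCtx {sig} ms γ) (bb : BBdry {sig} ms γ (cl , n))
                         (k : ∀ {δ} → Ren {sig} γ δ → Terms ms δ n → Arg {sig} ms δ (cl , 0)) : Set where
      field
        head-der : (Δ : VCtx {sig} ms δ) (ρ : Ren {sig} γ δ) (ts : Terms ms δ n)
                 → (∀ i → lookupTy Δ (ρ i) ≡ ren ρ (lookupTy Γ i))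
                 → All (Der T Θ Δ) (metaArgGoals bb (varSub ρ) ts) → Der T Θ Δ (B₀ (metaBdry bb (varSub ρ) ts))
                 → Der T Θ Δ (J₀ (fill₀ (metaBdry bb (varSub ρ) ts) (k ρ ts)))
    open DerivableHead

    hatGo-der : (Γ : VCtx {sig} ms γ) (bb : BBdry {sig} ms γ (cl , n))
                (k : ∀ {δ} → Ren {sig} γ δ → Terms ms δ n → Arg {sig} ms δ (cl , 0))
              → Der T Θ Γ (bdy bb) → DerivableHead Θ Γ bb k → Der T Θ Γ (jdg (fill bb (hatGo cl n k)))
    hatGo-der Γ (bdry b) k d head =
      castDer (cong J₀ (cong (λ X → fill₀ X _) (subBdry-id (λ _ → refl) b)))
        (head-der head Γ id [] (λ i → ≡sym (ren-id (λ _ → refl) (lookupTy Γ i))) []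
          (castDer (cong B₀ (≡sym (subBdry-id (λ _ → refl) b))) d))
    hatGo-der {Θ = Θ} Γ (babs A bb) k (TT-Bdry-Abstr dA dbb) head = TT-Abstr dA (hatGo-der (Γ ▷ A) bb _ dbb head′)
      where
      head′ : DerivableHead Θ (Γ ▷ A) bb (λ ρ ts → k (ρ ∘ suc) (var (ρ zero) ∷ ts))
      head′ .head-der Δ ρ ts ρ-types args bd =
        castDer (cong J₀ (cong (λ X → fill₀ X _) (metaBdry-cong ▸≗ bb ts)))
          (head-der head Δ (ρ ∘ suc) (var (ρ zero) ∷ ts)
            (λ i → trans (ρ-types (suc i)) (ren-ren (λ _ → refl) (lookupTy Γ i)))
            (castDer (cong J₀ (cong (hasType _) (trans (ρ-types zero) (trans (ren-ren (λ _ → refl) A) (ren≡sub _ A)))))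
                     (TT-Var (ρ zero))
              ∷ castDers (metaArgGoals-cong (≡sym ∘ ▸≗) bb ts) args)
            (castDer (cong B₀ (metaBdry-cong (≡sym ∘ ▸≗) bb ts)) bd))
        where
        ▸≗ : (var (ρ zero) ▸ varSub (ρ ∘ suc)) ≗ varSub ρ
        ▸≗ zero = refl
        ▸≗ (suc i) = refl

    hat-der : (M : MVar ms (cl , n)) → Der T Θ ∅ (bdy (lookupM Θ M)) → Der T Θ ∅ (jdg (fill (lookupM Θ M) (hat M)))
    hat-der {Θ = Θ} M d = hatGo-der ∅ (lookupM Θ M) _ d head
      where
      head : DerivableHead Θ ∅ (lookupM Θ M) (λ _ ts → mvHead M ts)
      head .head-der Δ ρ ts _ args bd =
        castDer (cong J₀ (cong (λ X → fill₀ X _) (metaBdry-cong (λ ()) (lookupM Θ M) ts)))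
          (TT-Meta M ts (castDers (metaArgGoals-cong (λ ()) (lookupM Θ M) ts) args)
                        (castDer (cong B₀ (metaBdry-cong (λ ()) (lookupM Θ M) ts)) bd))

    extendInst-der : (Ξ : MCtx {sig} sh) (bb : BBdry {sig} sh 0 a) (I : Inst {sig} ms 0 sh)
                   → DerivableInst T Θ ∅ Ξ I → Der T Θ ∅ (bdy (instBB I bb))
                   → DerivableInst T (Θ ▷ instBB I bb) ∅ (Ξ ▷ bb) (hat here ∷ wkInst I)
    extendInst-der {Θ = Θ} Ξ bb I ⊢I ⊢bb =
      castDer (cong (λ X → jdg (fill X (hat here))) (≡sym (instBB-wkInst I bb)))
              (hat-der here (mrenBB-there-der Θ (instBB I bb) ⊢bb))
      ∷ wkInst-der Θ (instBB I bb) Ξ I ⊢I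

    genInst-der : (Ξ : MCtx {sig} ms) → ⊢_mctx T Ξ → DerivableInst T Ξ ∅ Ξ (genInst ms)
    genInst-der ∅ tt = []
    genInst-der {ms = _ ∷ ms} (Ξ ▷ bb) (⊢Ξ , ⊢bb) =
      subst (λ bb′ → DerivableInst T (Ξ ▷ bb′) ∅ (Ξ ▷ bb) (genInst _)) (instBB-genInst bb)
            (extendInst-der Ξ bb (genInst ms) (genInst-der Ξ ⊢Ξ)
                            (subst (Der T Ξ ∅ ∘ bdy) (≡sym (instBB-genInst bb)) ⊢bb))

open Derivability

lemma3p15 : {sig : Signature} (T : RawTheory {sig})
    {ms : List Arity} {a : Arity}
    (Ξ : MCtx {sig} ms) (k : MVar ms a) (e : Arg {sig} (pre {sig} k) 0 a)
    → ⊢_mctx T Ξ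
    → Der T (Ξ ↾ k) ∅ (jdg (fill (Ξ ! k) e))
    → DerivableInst T (Ξ [ k ↦ e ]) ∅ Ξ (basicInst Ξ k e) × ⊢_mctx T (Ξ [ k ↦ e ])
lemma3p15 T (Ξ ▷ bb) here e (⊢Ξ , _) ⊢e rewrite genCtx-id Ξ | instBB-genInst bb =
  (⊢e ∷ genInst-der T Ξ ⊢Ξ) , ⊢Ξ
lemma3p15 T (Ξ ▷ bb) (there k) e (⊢Ξ , ⊢bb) ⊢e =
  let ⊢I , ⊢Ξ[k↦e] = lemma3p15 T Ξ k e ⊢Ξ ⊢e
      ⊢bb′ = instBB-der T Ξ (basicInst Ξ k e) ⊢I ⊢bb
  in extendInst-der T Ξ bb (basicInst Ξ k e) ⊢I ⊢bb′ , ⊢Ξ[k↦e] , ⊢bb′
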